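{- For each finite non-empty set $X$, let $k=k(X)$ be an integer with $k\ge\frac{2\ln(2e)|X|}{\ln(|X|/2)}$, let $r_1,\ldots,r_k$ be independent random subsets of $X$ each with the Binomial$(X,1/2)$ distribution, and let $x\in X$ be arbitrary. Then the probability that $R:=\{\emptyset,\{x\},X\setminus\{x\},r_1,\ldots,r_k\}$ resolves $(2^X,\mathrm{Jac})$ tends to $1$ as $|X|\to\infty$.
   Context: For a finite set $X$, $2^X$ is its power set. The Jaccard distance on $2^X$ is $\mathrm{Jac}(a,b)=|a\,\Delta\, b|/|a\cup b|$ for $a\neq b$ and $\mathrm{Jac}(a,a)=0$, where $\Delta$ is symmetric difference. A non-empty set $R\subseteq 2^X$ resolves $(2^X,\mathrm{Jac})$ if the map $a\mapsto (\mathrm{Jac}(a,r))_{r\in R}$ is injective on $2^X$. A random $r\in 2^X$ has the Binomial$(X,1/2)$ distribution if $\mathbb{P}(x\in r)=1/2$ for each $x\in X$ and the events $[x\in r]$, $x\in X$, are independent. (The paper phrases the conclusion as "with overwhelmingly high probability, as $|X|\to\infty$".) -}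

module Defs where

open import Data.Bool using (Bool; true; false)
open import Data.Nat as ℕ using (ℕ; zero; suc; _^_; _*_; _!)
open import Data.Nat.Properties using (m^n≢0; _!≢0)
open import Data.Integer using (+_)
open import Data.Rational using (ℚ; 0ℚ; _/_; _+_; _≤_) renaming (_*_ to _*ℚ_)
open import Data.Rational.Properties using () renaming (_≟_ to _≟ℚ_)
open import Data.Fin using (Fin)
open import Data.Fin.Subset using (Subset; _∪_; _─_; ∣_∣; ⁅_⁆; ∁; ⊥)
open import Data.Fin.Subset.Properties using (anySubset?)
open import Data.Vec using (Vec; []; _∷_; toList)
open import Data.Vec.Properties using (≡-dec)
open import Data.Bool.Properties using () renaming (_≟_ to _≟B_)
open import Data.List using (List; []; _∷_; map; _++_; concatMap; length; filter)
open import Data.List.Relation.Unary.All using (All; all?)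
open import Data.Product using (_,_; proj₁; proj₂)
open import Function using (_∘_)
open import Relation.Binary.PropositionalEquality using (_≡_)
open import Relation.Nullary using (Dec; yes; no; ¬_; ¬?; map′; _→-dec_)
open import Relation.Nullary.Decidable using (decidable-stable)

_Δ_ : ∀ {n} → Subset n → Subset n → Subset n
a Δ b = (a ─ b) ∪ (b ─ a)

-- Jac a b = |a Δ b| / |a ∪ b|.  When |a ∪ b| = 0 we have a = b = ∅ and
-- Jac = 0; when a = b ≠ ∅ the formula already gives 0 since a Δ a = ∅.
Jac : ∀ {n} → Subset n → Subset n → ℚ
Jac a b with ∣ a ∪ b ∣
... | zero  = 0ℚ
... | suc m = (+ ∣ a Δ b ∣) / suc m

Resolves : ∀ {n} → List (Subset n) → Set
Resolves {n} R = (a b : Subset n) → All (λ r → Jac a r ≡ Jac b r) R → a ≡ b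

allSubset? : ∀ {n} {P : Subset n → Set} → ((s : Subset n) → Dec (P s)) →
             Dec ((s : Subset n) → P s)
allSubset? {n} {P} P? =
  map′ (λ ¬∃¬ s → decidable-stable (P? s) (λ ¬p → ¬∃¬ (s , ¬p)))
       (λ ∀P ∃¬ → proj₂ ∃¬ (∀P (proj₁ ∃¬)))
       (¬? (anySubset? (λ s → ¬? (P? s))))

resolves? : ∀ {n} (R : List (Subset n)) → Dec (Resolves R)
resolves? R = allSubset? λ a → allSubset? λ b →
  all? (λ r → Jac a r ≟ℚ Jac b r) R →-dec ≡-dec _≟B_ a b

-- the probability space: k independent Binomial(X,1/2) subsets, i.e. the
-- uniform distribution on (2^X)^k, of size 2^(n*k)

allSubsets : ∀ n → List (Subset n)
allSubsets zero    = [] ∷ []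
allSubsets (suc n) = map (true ∷_) (allSubsets n) ++ map (false ∷_) (allSubsets n)

allTuples : ∀ n k → List (Vec (Subset n) k)
allTuples n zero    = [] ∷ []
allTuples n (suc k) = concatMap (λ s → map (s ∷_) (allTuples n k)) (allSubsets n)

familyR : ∀ {n k} → Fin n → Vec (Subset n) k → List (Subset n)
familyR x rs = ⊥ ∷ ⁅ x ⁆ ∷ ∁ ⁅ x ⁆ ∷ toList rs

probResolves : (n k : ℕ) → Fin n → ℚ
probResolves n k x =
  _/_ (+ length (filter (resolves? ∘ familyR x) (allTuples n k)))
      (2 ^ (n * k)) {{m^n≢0 2 (n * k)}}

-- the bound k ≥ 2 ln(2e) n / ln(n/2)   (for n ≥ 3, where ln(n/2) > 0)
-- is equivalent to (2e)^(2n) ≤ (n/2)^k, i.e. 4^n · exp(2n) ≤ n^k / 2^k,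
-- with exp(t) = Σ_{i ≥ 0} t^i / i!  (series of non-negative terms, so
-- exp(t) ≤ q iff every partial sum is ≤ q).

expPartial : ℕ → ℕ → ℚ
expPartial t zero    = 0ℚ
expPartial t (suc m) = expPartial t m + _/_ (+ (t ^ m)) (m !) {{m !≢0}}

KBound : ℕ → ℕ → Set
KBound n k = ∀ m → ((+ (4 ^ n)) / 1) *ℚ expPartial (2 * n) m
                   ≤ _/_ (+ (n ^ k)) (2 ^ k) {{m^n≢0 2 k}}

module Submission where

-- The references {x} and
-- X ∖ {x} force ∣a∣ = ∣b∣, and then Jac a r = Jac b r iff ∣a ∩ r∣ = ∣b ∩ r∣, i.e. r meets A = a ∖ b and
-- B = b ∖ a equally often, where ∣A∣ = ∣B∣ = d ≥ 1.  A uniform r does so with probability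
-- C(2d, d) / 4^d ≤ 1 / √(2d + 1), so by a union bound over the at most 3ⁿ pairs (A, B) the failure
-- probability is at most the sum of (2d + 1)^(−k/2).  Pairs with d ≥ D ≈ n^(9/10) contribute at most
-- 3ⁿ D^(−k/2), the at most (2n + 1)^(2D) others at most 3^(−k/2) each, and both totals vanish because
-- the hypothesis on k gives (n/2)^k ≥ 2^(4n − 1), so that k ≳ 4n / log₂ n.

open import Defs

-- An anonymous module keeps its imports, ℕ's _<_ among them, out of the scope of the statement.
module _ where

  open import Data.Bool using (Bool; true; false; T; not; _∧_; _∨_; if_then_else_)
  open import Data.Bool.ListAction using (any; all)
  open import Data.Bool.Properties using (T-∧; T-≡; T-not-≡; not-involutive) renaming (_≟_ to _≟ᵇ_)
  open import Data.Empty using (⊥-elim)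
  open import Data.Fin using (Fin)
  open import Data.Fin.Subset using (Subset; _∪_; _∩_; ∁; ∣_∣; ⁅_⁆)
  open import Data.Fin.Subset.Properties using (∣p∩q∣≤∣q∣; ∣q∣≤∣p∪q∣; ∣⁅x⁆∣≡1; ∣∁p∣≡n∸∣p∣)
  import Data.Integer as ℤ
  open import Data.Integer using (+[1+_])
  import Data.Integer.Properties as ℤ
  open import Data.List using (List; []; _∷_; map; _++_; concatMap; length; filter)
  open import Data.List.Membership.Propositional using (_∈_; lose)
  open import Data.List.Membership.Propositional.Properties using (∈-map⁺; ∈-++⁺ˡ; ∈-++⁺ʳ)
  open import Data.List.Properties using (length-++; length-map; map-cong)
  open import Data.List.Relation.Unary.All as All using (_∷_; universal)
  open import Data.List.Relation.Unary.All.Properties using (all⁻)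
  open import Data.List.Relation.Unary.Any using (here)
  open import Data.List.Relation.Unary.Any.Properties using (any⁺)
  open import Data.Nat using (ℕ; zero; suc; pred; _+_; _*_; _∸_; _^_; _!; _≤_; _<_; z≤n; s≤s; NonZero; >-nonZero; _≡ᵇ_; _<ᵇ_; _≤ᵇ_)
  open import Data.Nat.Combinatorics using (_C_; nC1≡n; nCk≡nC[n∸k]; nCk+nC[k+1]≡[n+1]C[k+1])
  open import Data.Nat.Coprimality using (Coprime)
  open import Data.Nat.DivMod using (_/_; _%_; m≡m%n+[m/n]*n; m%n<n)
  open import Data.Nat.ListAction using (sum)
  open import Data.Nat.Properties
  open import Data.Nat.Tactic.RingSolver using (solve-∀)
  open import Algebra.Properties.CommutativeSemigroup *-commutativeSemigroup using (x∙yz≈y∙xz)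
  open import Data.Product using (Σ; _×_; _,_; proj₁; proj₂)
  open import Data.Rational as ℚ using (ℚ; mkℚ; 0ℚ; 1ℚ; toℚᵘ)
  import Data.Rational.Properties as ℚ
  open import Data.Rational.Unnormalised as ℚᵘ using (mkℚᵘ; *≤*; *≡*)
  import Data.Rational.Unnormalised.Properties as ℚᵘ
  open import Data.Vec using (Vec; []; _∷_; toList)
  open import Data.Vec.Properties using (≡-dec)
  open import Function using (_∘_; Equivalence)
  open import Relation.Binary.PropositionalEquality
  open import Relation.Nullary using (does; yes; no; contradiction)
  open import Relation.Nullary.Decidable using (dec-true)
  open import Relation.Unary using (Decidable)

  ^-distribʳ-* : ∀ m n p → (m * n) ^ p ≡ m ^ p * n ^ p
  ^-distribʳ-* m n zero    = refl
  ^-distribʳ-* m n (suc p) = trans (cong (m * n *_) (^-distribʳ-* m n p)) (interchange m n (m ^ p) (n ^ p))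
    where interchange : ∀ m n x y → m * n * (x * y) ≡ m * x * (n * y)
          interchange = solve-∀

  ^-swap : ∀ a m o → (a ^ m) ^ o ≡ (a ^ o) ^ m
  ^-swap a m o = trans (^-*-assoc a m o) (trans (cong (a ^_) (*-comm m o)) (sym (^-*-assoc a o m)))

  ^-cancelˡ-≤ : ∀ n {x y} → x ^ suc n ≤ y ^ suc n → x ≤ y
  ^-cancelˡ-≤ n {x} {y} le with x ≤? y
  ... | yes x≤y = x≤y
  ... | no  x≰y = contradiction le (<⇒≱ (^-monoˡ-< (suc n) (≰⇒> x≰y)))

  ^-cancelʳ-≤ : ∀ b {m n} → 1 < b → b ^ m ≤ b ^ n → m ≤ n
  ^-cancelʳ-≤ b {m} {n} 1<b le with m ≤? n
  ... | yes m≤n = m≤n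
  ... | no  m≰n = contradiction le (<⇒≱ (^-monoʳ-< b 1<b (≰⇒> m≰n)))

  n<2^n : ∀ n → n < 2 ^ n
  n<2^n zero    = s≤s z≤n
  n<2^n (suc n) = begin-strict
    suc n           <⟨ s≤s (n<2^n n) ⟩
    suc (2 ^ n)     ≡⟨ +-comm 1 (2 ^ n) ⟩
    2 ^ n + 1       ≤⟨ +-monoʳ-≤ (2 ^ n) (≤-trans (m^n>0 2 n) (m≤m+n (2 ^ n) 0)) ⟩
    2 ^ n + (2 ^ n + 0) ∎
    where open ≤-Reasoning

  n^n≢0 : ∀ n → NonZero (n ^ n)
  n^n≢0 zero    = _
  n^n≢0 (suc n) = m^n≢0 (suc n) (suc n)

  -- Counting in finite enumerations

  module _ {A : Set} where

    count : (A → Bool) → List A → ℕ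
    count p []       = 0
    count p (x ∷ xs) = if p x then suc (count p xs) else count p xs

    length-filter≡count : ∀ {P : A → Set} (P? : Decidable P) xs →
                          length (filter P? xs) ≡ count (does ∘ P?) xs
    length-filter≡count P? []       = refl
    length-filter≡count P? (x ∷ xs) with does (P? x)
    ... | true  = cong suc (length-filter≡count P? xs)
    ... | false = length-filter≡count P? xs

    count-++ : ∀ p (xs ys : List A) → count p (xs ++ ys) ≡ count p xs + count p ys
    count-++ p []       ys = refl
    count-++ p (x ∷ xs) ys with p x
    ... | true  = cong suc (count-++ p xs ys)
    ... | false = count-++ p xs ys

    count-mono : ∀ {p q} → (∀ x → T (p x) → T (q x)) → ∀ xs → count p xs ≤ count q xs
    count-mono               p⇒q []       = z≤n
    count-mono {p = p} {q} p⇒q (x ∷ xs) with p x in px | q x in qx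
    ... | true  | true  = s≤s (count-mono p⇒q xs)
    ... | true  | false = ⊥-elim (subst T qx (p⇒q x (subst T (sym px) _)))
    ... | false | true  = m≤n⇒m≤1+n (count-mono p⇒q xs)
    ... | false | false = count-mono p⇒q xs

    count-cong : ∀ {p q} → (∀ x → T (p x) → T (q x)) → (∀ x → T (q x) → T (p x)) →
                 ∀ xs → count p xs ≡ count q xs
    count-cong p⇒q q⇒p xs = ≤-antisym (count-mono p⇒q xs) (count-mono q⇒p xs)

    count-const : ∀ b (xs : List A) → count (λ _ → b) xs ≡ (if b then length xs else 0)
    count-const true  []       = refl
    count-const true  (x ∷ xs) = cong suc (count-const true xs)
    count-const false []       = refl
    count-const false (x ∷ xs) = count-const false xs

    count+count-not : ∀ p (xs : List A) → count p xs + count (not ∘ p) xs ≡ length xs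
    count+count-not p []       = refl
    count+count-not p (x ∷ xs) with p x
    ... | true  = cong suc (count+count-not p xs)
    ... | false = trans (+-suc _ _) (cong suc (count+count-not p xs))

    count-∨ : ∀ p q (xs : List A) → count (λ x → p x ∨ q x) xs ≤ count p xs + count q xs
    count-∨ p q []       = z≤n
    count-∨ p q (x ∷ xs) with p x | q x
    ... | true  | true  = s≤s (≤-trans (count-∨ p q xs) (+-monoʳ-≤ (count p xs) (n≤1+n _)))
    ... | true  | false = s≤s (count-∨ p q xs)
    ... | false | true  = ≤-trans (s≤s (count-∨ p q xs)) (≤-reflexive (sym (+-suc _ _)))
    ... | false | false = count-∨ p q xs

    count-const∧ : ∀ b p (xs : List A) → count (λ x → b ∧ p x) xs ≡ (if b then count p xs else 0)
    count-const∧ true  p xs = refl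
    count-const∧ false p xs = count-const false xs

    sum-if≡count* : ∀ p c (xs : List A) → sum (map (λ x → if p x then c else 0) xs) ≡ count p xs * c
    sum-if≡count* p c []       = refl
    sum-if≡count* p c (x ∷ xs) with p x
    ... | true  = cong (c +_) (sum-if≡count* p c xs)
    ... | false = sum-if≡count* p c xs

    sum-map-+ : ∀ (f g : A → ℕ) xs → sum (map (λ x → f x + g x) xs) ≡ sum (map f xs) + sum (map g xs)
    sum-map-+ f g []       = refl
    sum-map-+ f g (x ∷ xs) = trans (cong (f x + g x +_) (sum-map-+ f g xs)) (interchange (f x) (g x) _ _)
      where interchange : ∀ a b c d → a + b + (c + d) ≡ a + c + (b + d)
            interchange = solve-∀

    sum*≤count* : ∀ (f : A → ℕ) p {K B} → (∀ x → f x * K ≤ (if p x then B else 0)) →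
                  ∀ xs → sum (map f xs) * K ≤ count p xs * B
    sum*≤count* f p           bound []       = z≤n
    sum*≤count* f p {K} {B} bound (x ∷ xs) with p x | bound x
    ... | true  | fx*K≤B = ≤-trans (≤-reflexive (*-distribʳ-+ K (f x) _)) (+-mono-≤ fx*K≤B (sum*≤count* f p bound xs))
    ... | false | fx*K≤0 = ≤-trans (≤-reflexive (*-distribʳ-+ K (f x) _)) (≤-trans (+-monoˡ-≤ _ fx*K≤0) (sum*≤count* f p bound xs))

  module _ {A B : Set} where

    count-map : ∀ p (f : A → B) xs → count p (map f xs) ≡ count (p ∘ f) xs
    count-map p f []       = refl
    count-map p f (x ∷ xs) with p (f x)
    ... | true  = cong suc (count-map p f xs)
    ... | false = count-map p f xs

    count-concatMap : ∀ p (f : A → List B) xs →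
                      count p (concatMap f xs) ≡ sum (map (count p ∘ f) xs)
    count-concatMap p f []       = refl
    count-concatMap p f (x ∷ xs) =
      trans (count-++ p (f x) (concatMap f xs)) (cong (count p (f x) +_) (count-concatMap p f xs))

    count-any≤sum : ∀ (h : A → B → Bool) ls xs →
                    count (λ x → any (λ l → h l x) ls) xs ≤ sum (map (λ l → count (h l) xs) ls)
    count-any≤sum h []       xs = ≤-reflexive (count-const false xs)
    count-any≤sum h (l ∷ ls) xs = ≤-trans (count-∨ (h l) (λ x → any (λ l → h l x) ls) xs)
                                          (+-monoʳ-≤ (count (h l) xs) (count-any≤sum h ls xs))

  length-allSubsets : ∀ n → length (allSubsets n) ≡ 2 ^ n
  length-allSubsets zero    = refl
  length-allSubsets (suc n) = begin
    length (map (true ∷_) S ++ map (false ∷_) S)      ≡⟨ length-++ (map (true ∷_) S) ⟩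
    length (map (true ∷_) S) + length (map (false ∷_) S)
      ≡⟨ cong₂ _+_ (length-map (true ∷_) S) (length-map (false ∷_) S) ⟩
    length S + length S                              ≡⟨ cong (λ m → m + m) (length-allSubsets n) ⟩
    2 ^ n + 2 ^ n                                    ≡⟨ cong (2 ^ n +_) (sym (+-identityʳ (2 ^ n))) ⟩
    2 ^ suc n                                        ∎
    where open ≡-Reasoning
          S = allSubsets n

  count-allSubsets-suc : ∀ n (p : Subset (suc n) → Bool) →
    count p (allSubsets (suc n)) ≡ count (p ∘ (true ∷_)) (allSubsets n) + count (p ∘ (false ∷_)) (allSubsets n)
  count-allSubsets-suc n p = trans (count-++ p (map (true ∷_) (allSubsets n)) _)
    (cong₂ _+_ (count-map p (true ∷_) (allSubsets n)) (count-map p (false ∷_) (allSubsets n)))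

  count-allTuples : ∀ n k (p : Subset n → Bool) →
                    count (all p ∘ toList) (allTuples n k) ≡ count p (allSubsets n) ^ k
  count-allTuples n zero    p = refl
  count-allTuples n (suc k) p = begin
    count (all p ∘ toList) (concatMap (λ s → map (s ∷_) Rs) S)
      ≡⟨ count-concatMap (all p ∘ toList) (λ s → map (s ∷_) Rs) S ⟩
    sum (map (λ s → count (all p ∘ toList) (map (s ∷_) Rs)) S)
      ≡⟨ cong sum (map-cong extend S) ⟩
    sum (map (λ s → if p s then count p S ^ k else 0) S)
      ≡⟨ sum-if≡count* p (count p S ^ k) S ⟩
    count p S * count p S ^ k
      ∎
    where
    open ≡-Reasoning
    S  = allSubsets n
    Rs = allTuples n k
    extend : ∀ s → count (all p ∘ toList) (map (s ∷_) Rs) ≡ (if p s then count p S ^ k else 0)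
    extend s = begin
      count (all p ∘ toList) (map (s ∷_) Rs)       ≡⟨ count-map (all p ∘ toList) (s ∷_) Rs ⟩
      count (λ rs → p s ∧ all p (toList rs)) Rs     ≡⟨ count-const∧ (p s) (all p ∘ toList) Rs ⟩
      (if p s then count (all p ∘ toList) Rs else 0) ≡⟨ cong (if p s then_else 0) (count-allTuples n k p) ⟩
      (if p s then count p S ^ k else 0)            ∎

  length-allTuples : ∀ n k → length (allTuples n k) ≡ 2 ^ (n * k)
  length-allTuples n k = begin
    length (allTuples n k)                          ≡⟨ count-const true (allTuples n k) ⟨
    count (λ _ → true) (allTuples n k)
      ≡⟨ count-cong (λ rs _ → all⁻ (λ _ → true) (universal _ (toList rs))) (λ _ _ → _) (allTuples n k) ⟩
    count (all (λ _ → true) ∘ toList) (allTuples n k) ≡⟨ count-allTuples n k (λ _ → true) ⟩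
    count (λ _ → true) (allSubsets n) ^ k           ≡⟨ cong (_^ k) (count-const true (allSubsets n)) ⟩
    length (allSubsets n) ^ k                       ≡⟨ cong (_^ k) (length-allSubsets n) ⟩
    (2 ^ n) ^ k                                     ≡⟨ ^-*-assoc 2 n k ⟩
    2 ^ (n * k)                                     ∎
    where open ≡-Reasoning

  -- Central binomial coefficients

  [1+k]*[1+n]C[1+k]≡[1+n]*nCk : ∀ n k → suc k * (suc n C suc k) ≡ suc n * (n C k)
  [1+k]*[1+n]C[1+k]≡[1+n]*nCk zero    zero    = refl
  [1+k]*[1+n]C[1+k]≡[1+n]*nCk zero    (suc k) = *-zeroʳ (suc (suc k))
  [1+k]*[1+n]C[1+k]≡[1+n]*nCk (suc n) zero    = trans (+-identityʳ _) (trans (nC1≡n (suc (suc n))) (sym (*-identityʳ _)))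
  [1+k]*[1+n]C[1+k]≡[1+n]*nCk (suc n) (suc k) = begin
    2+k * (2+n C 2+k)                                   ≡⟨ cong (2+k *_) (pascal (suc n) (suc k)) ⟨
    2+k * (1+n C 1+k + 1+n C 2+k)                       ≡⟨ split (suc k) (1+n C 1+k) (1+n C 2+k) ⟩
    1+k * (1+n C 1+k) + 1+n C 1+k + 2+k * (1+n C 2+k)
      ≡⟨ cong₂ (λ x y → x + 1+n C 1+k + y) ([1+k]*[1+n]C[1+k]≡[1+n]*nCk n k)
                                            ([1+k]*[1+n]C[1+k]≡[1+n]*nCk n (suc k)) ⟩
    1+n * (n C k) + 1+n C 1+k + 1+n * (n C 1+k)        ≡⟨ cong (λ x → 1+n * (n C k) + x + 1+n * (n C 1+k)) (pascal n k) ⟨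
    1+n * (n C k) + (n C k + n C 1+k) + 1+n * (n C 1+k) ≡⟨ merge (suc n) (n C k) (n C suc k) ⟩
    2+n * (n C k + n C 1+k)                             ≡⟨ cong (2+n *_) (pascal n k) ⟩
    2+n * (1+n C 1+k)                                   ∎
    where
    open ≡-Reasoning
    pascal = nCk+nC[k+1]≡[n+1]C[k+1]
    1+n = suc n
    2+n = suc (suc n)
    1+k = suc k
    2+k = suc (suc k)
    split : ∀ a x y → suc a * (x + y) ≡ a * x + x + suc a * y
    split = solve-∀
    merge : ∀ a x y → a * x + (x + y) + a * y ≡ suc a * (x + y)
    merge = solve-∀

  central : ℕ → ℕ
  central d = (2 * d) C d

  central-ratio : ∀ d → suc d * central (suc d) ≡ 2 * suc (2 * d) * central d
  central-ratio d = *-cancelˡ-≡ _ _ (suc d) (begin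
    suc d * (suc d * ((2 * suc d) C suc d))  ≡⟨ cong (λ m → suc d * (suc d * (m C suc d))) (*-suc 2 d) ⟩
    suc d * (suc d * (suc (suc N) C suc d))  ≡⟨ cong (suc d *_) ([1+k]*[1+n]C[1+k]≡[1+n]*nCk (suc N) d) ⟩
    suc d * (suc (suc N) * (suc N C d))      ≡⟨ x∙yz≈y∙xz (suc d) (suc (suc N)) (suc N C d) ⟩
    suc (suc N) * (suc d * (suc N C d))      ≡⟨ cong (λ m → suc (suc N) * (suc d * m)) symmetric ⟩
    suc (suc N) * (suc d * (suc N C suc d))  ≡⟨ cong (suc (suc N) *_) ([1+k]*[1+n]C[1+k]≡[1+n]*nCk N d) ⟩
    suc (suc N) * (suc N * (N C d))          ≡⟨ regroup d (N C d) ⟩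
    suc d * (2 * suc N * (N C d))            ∎)
    where
    open ≡-Reasoning
    N = 2 * d
    1+N∸d≡1+d : suc N ∸ d ≡ suc d
    1+N∸d≡1+d = trans (cong (λ m → suc (d + m) ∸ d) (+-identityʳ d))
                      (trans (cong (_∸ d) (sym (+-suc d d))) (m+n∸m≡n d (suc d)))
    symmetric : suc N C d ≡ suc N C suc d
    symmetric = trans (nCk≡nC[n∸k] (≤-trans (m≤m+n d (d + 0)) (n≤1+n N))) (cong (suc N C_) 1+N∸d≡1+d)
    regroup : ∀ d c → suc (suc (2 * d)) * (suc (2 * d) * c) ≡ suc d * (2 * suc (2 * d) * c)
    regroup = solve-∀

  central-bound : ∀ d → central d * central d * suc (2 * d) ≤ 16 ^ d
  central-bound zero    = ≤-refl
  central-bound (suc d) = *-cancelˡ-≤ (suc d * suc d) (begin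
    suc d * suc d * (c′ * c′ * suc (2 * suc d))                  ≡⟨ regroup (suc d) c′ _ ⟩
    suc d * c′ * (suc d * c′) * suc (2 * suc d)                  ≡⟨ cong (λ z → z * z * suc (2 * suc d)) (central-ratio d) ⟩
    2 * suc (2 * d) * c * (2 * suc (2 * d) * c) * suc (2 * suc d) ≡⟨ regroup′ (suc (2 * d)) c (suc (2 * suc d)) ⟩
    4 * (c * c * suc (2 * d)) * (suc (2 * d) * suc (2 * suc d))   ≤⟨ *-mono-≤ (*-monoʳ-≤ 4 (central-bound d)) (odd-product d) ⟩
    4 * 16 ^ d * (4 * (suc d * suc d))                          ≡⟨ regroup″ (16 ^ d) (suc d * suc d) ⟩
    suc d * suc d * 16 ^ suc d                                   ∎)
    where
    open ≤-Reasoning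
    c = central d
    c′ = central (suc d)
    regroup : ∀ a c s → a * a * (c * c * s) ≡ a * c * (a * c) * s
    regroup = solve-∀
    regroup′ : ∀ a c s → 2 * a * c * (2 * a * c) * s ≡ 4 * (c * c * a) * (a * s)
    regroup′ = solve-∀
    regroup″ : ∀ x y → 4 * x * (4 * y) ≡ y * (16 * x)
    regroup″ = solve-∀
    odd-product : ∀ d → suc (2 * d) * suc (2 * suc d) ≤ 4 * (suc d * suc d)
    odd-product d = ≤-trans (n≤1+n _) (≤-reflexive (expand d))
      where expand : ∀ d → suc (suc (2 * d) * suc (2 * suc d)) ≡ 4 * (suc d * suc d)
            expand = solve-∀

  -- Jaccard distance

  ∣p∪q∣≡∣pΔq∣+∣p∩q∣ : ∀ {n} (p q : Subset n) → ∣ p ∪ q ∣ ≡ ∣ p Δ q ∣ + ∣ p ∩ q ∣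
  ∣p∪q∣≡∣pΔq∣+∣p∩q∣ [] [] = refl
  ∣p∪q∣≡∣pΔq∣+∣p∩q∣ (true  ∷ p) (true  ∷ q) = trans (cong suc (∣p∪q∣≡∣pΔq∣+∣p∩q∣ p q)) (sym (+-suc _ _))
  ∣p∪q∣≡∣pΔq∣+∣p∩q∣ (true  ∷ p) (false ∷ q) = cong suc (∣p∪q∣≡∣pΔq∣+∣p∩q∣ p q)
  ∣p∪q∣≡∣pΔq∣+∣p∩q∣ (false ∷ p) (true  ∷ q) = cong suc (∣p∪q∣≡∣pΔq∣+∣p∩q∣ p q)
  ∣p∪q∣≡∣pΔq∣+∣p∩q∣ (false ∷ p) (false ∷ q) = ∣p∪q∣≡∣pΔq∣+∣p∩q∣ p q

  ∣p∣+∣q∣≡∣p∪q∣+∣p∩q∣ : ∀ {n} (p q : Subset n) → ∣ p ∣ + ∣ q ∣ ≡ ∣ p ∪ q ∣ + ∣ p ∩ q ∣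
  ∣p∣+∣q∣≡∣p∪q∣+∣p∩q∣ [] [] = refl
  ∣p∣+∣q∣≡∣p∪q∣+∣p∩q∣ (true  ∷ p) (true  ∷ q) =
    cong suc (trans (+-suc _ _) (trans (cong suc (∣p∣+∣q∣≡∣p∪q∣+∣p∩q∣ p q)) (sym (+-suc _ _))))
  ∣p∣+∣q∣≡∣p∪q∣+∣p∩q∣ (true  ∷ p) (false ∷ q) = cong suc (∣p∣+∣q∣≡∣p∪q∣+∣p∩q∣ p q)
  ∣p∣+∣q∣≡∣p∪q∣+∣p∩q∣ (false ∷ p) (true  ∷ q) = trans (+-suc _ _) (cong suc (∣p∣+∣q∣≡∣p∪q∣+∣p∩q∣ p q))
  ∣p∣+∣q∣≡∣p∪q∣+∣p∩q∣ (false ∷ p) (false ∷ q) = ∣p∣+∣q∣≡∣p∪q∣+∣p∩q∣ p q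

  ∣p∩q∣+∣p∩∁q∣≡∣p∣ : ∀ {n} (p q : Subset n) → ∣ p ∩ q ∣ + ∣ p ∩ ∁ q ∣ ≡ ∣ p ∣
  ∣p∩q∣+∣p∩∁q∣≡∣p∣ [] [] = refl
  ∣p∩q∣+∣p∩∁q∣≡∣p∣ (true  ∷ p) (true  ∷ q) = cong suc (∣p∩q∣+∣p∩∁q∣≡∣p∣ p q)
  ∣p∩q∣+∣p∩∁q∣≡∣p∣ (true  ∷ p) (false ∷ q) = trans (+-suc _ _) (cong suc (∣p∩q∣+∣p∩∁q∣≡∣p∣ p q))
  ∣p∩q∣+∣p∩∁q∣≡∣p∣ (false ∷ p) (_     ∷ q) = ∣p∩q∣+∣p∩∁q∣≡∣p∣ p q

  ∣p∪r∣≡0⇒∣q∩r∣≡0 : ∀ {n} (p q r : Subset n) → ∣ p ∪ r ∣ ≡ 0 → ∣ q ∩ r ∣ ≡ 0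
  ∣p∪r∣≡0⇒∣q∩r∣≡0 p q r e = n≤0⇒n≡0 (≤-trans (∣p∩q∣≤∣q∣ q r) (≤-trans (∣q∣≤∣p∪q∣ p r) (≤-reflexive e)))

  private
    cross-ratio : ∀ D t D′ t′ → D * (D′ + t′) ≡ D′ * (D + t) → t′ * (D + t + t) ≡ t * (D′ + t′ + t′)
    cross-ratio D t D′ t′ eq = begin
      t′ * (D + t + t)          ≡⟨ expandˡ D t t′ ⟩
      D * t′ + 2 * (t * t′)     ≡⟨ cong (_+ 2 * (t * t′)) Dt′≡D′t ⟩
      D′ * t + 2 * (t * t′)     ≡⟨ expandʳ D′ t t′ ⟩
      t * (D′ + t′ + t′)        ∎
      where
      open ≡-Reasoning
      expandˡ : ∀ D t t′ → t′ * (D + t + t) ≡ D * t′ + 2 * (t * t′)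
      expandˡ = solve-∀
      expandʳ : ∀ D′ t t′ → D′ * t + 2 * (t * t′) ≡ t * (D′ + t′ + t′)
      expandʳ = solve-∀
      Dt′≡D′t : D * t′ ≡ D′ * t
      Dt′≡D′t = +-cancelˡ-≡ (D * D′) _ _ (begin
        D * D′ + D * t′   ≡⟨ *-distribˡ-+ D D′ t′ ⟨
        D * (D′ + t′)     ≡⟨ eq ⟩
        D′ * (D + t)      ≡⟨ *-distribˡ-+ D′ D t ⟩
        D′ * D + D′ * t   ≡⟨ cong (_+ D′ * t) (*-comm D′ D) ⟩
        D * D′ + D′ * t   ∎)

  -- With t = ∣a ∩ r∣ and S = ∣a∣ + ∣r∣, Jac a r = (S − 2t) / (S − t), so equal distances force t : S to agree.
  Jac≡⇒cross : ∀ {n} (a b r : Subset n) → Jac a r ≡ Jac b r →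
               ∣ b ∩ r ∣ * (∣ a ∣ + ∣ r ∣) ≡ ∣ a ∩ r ∣ * (∣ b ∣ + ∣ r ∣)
  Jac≡⇒cross a b r eq with ∣ a ∪ r ∣ in a∪r | ∣ b ∪ r ∣ in b∪r
  ... | zero  | _     rewrite ∣p∪r∣≡0⇒∣q∩r∣≡0 a a r a∪r | ∣p∪r∣≡0⇒∣q∩r∣≡0 a b r a∪r = refl
  ... | suc _ | zero  rewrite ∣p∪r∣≡0⇒∣q∩r∣≡0 b a r b∪r | ∣p∪r∣≡0⇒∣q∩r∣≡0 b b r b∪r = refl
  ... | suc u | suc v = begin
    t′ * (∣ a ∣ + ∣ r ∣)  ≡⟨ cong (t′ *_) (sizes a a∪r) ⟩
    t′ * (D + t + t)      ≡⟨ cross-ratio D t D′ t′ (subst₂ (λ U′ U → D * U′ ≡ D′ * U) (unions b b∪r) (unions a a∪r) Jac-eq) ⟩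
    t * (D′ + t′ + t′)    ≡⟨ cong (t *_) (sizes b b∪r) ⟨
    t * (∣ b ∣ + ∣ r ∣)   ∎
    where
    open ≡-Reasoning
    t = ∣ a ∩ r ∣
    t′ = ∣ b ∩ r ∣
    D = ∣ a Δ r ∣
    D′ = ∣ b Δ r ∣
    Jac-eq : D * suc v ≡ D′ * suc u
    Jac-eq = ℚ.normalize-injective-≃ D D′ (suc u) (suc v) eq
    unions : ∀ c {w} → ∣ c ∪ r ∣ ≡ w → w ≡ ∣ c Δ r ∣ + ∣ c ∩ r ∣
    unions c refl = ∣p∪q∣≡∣pΔq∣+∣p∩q∣ c r
    sizes : ∀ c {w} → ∣ c ∪ r ∣ ≡ w → ∣ c ∣ + ∣ r ∣ ≡ ∣ c Δ r ∣ + ∣ c ∩ r ∣ + ∣ c ∩ r ∣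
    sizes c e = trans (∣p∣+∣q∣≡∣p∪q∣+∣p∩q∣ c r) (cong (_+ ∣ c ∩ r ∣) (trans e (unions c e)))

  private
    *-cancelʳ-≡-bounded : ∀ {t t′ S} → t ≤ S → t′ ≤ S → t′ * S ≡ t * S → t ≡ t′
    *-cancelʳ-≡-bounded {S = zero}  t≤0 t′≤0 _ = trans (n≤0⇒n≡0 t≤0) (sym (n≤0⇒n≡0 t′≤0))
    *-cancelʳ-≡-bounded {S = suc S} _   _    e = sym (*-cancelʳ-≡ _ _ (suc S) e)

  Jac≡⇒∣∩∣≡ : ∀ {n} (a b r : Subset n) → ∣ a ∣ ≡ ∣ b ∣ → Jac a r ≡ Jac b r → ∣ a ∩ r ∣ ≡ ∣ b ∩ r ∣
  Jac≡⇒∣∩∣≡ a b r ∣a∣≡∣b∣ eq = *-cancelʳ-≡-bounded (bounded a) (bounded b) cross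
    where
    bounded : ∀ c → ∣ c ∩ r ∣ ≤ ∣ a ∣ + ∣ r ∣
    bounded c = ≤-trans (∣p∩q∣≤∣q∣ c r) (m≤n+m ∣ r ∣ ∣ a ∣)
    cross : ∣ b ∩ r ∣ * (∣ a ∣ + ∣ r ∣) ≡ ∣ a ∩ r ∣ * (∣ a ∣ + ∣ r ∣)
    cross = subst (λ s → ∣ b ∩ r ∣ * (∣ a ∣ + ∣ r ∣) ≡ ∣ a ∩ r ∣ * (s + ∣ r ∣))
                  (sym ∣a∣≡∣b∣) (Jac≡⇒cross a b r eq)

  private
    sizes-from-crosses : ∀ {t u t′ u′ m} → t ≤ 1 → t′ ≤ 1 → 1 ≤ m →
                         t′ * (t + u + 1) ≡ t * (t′ + u′ + 1) →
                         u′ * (t + u + m) ≡ u * (t′ + u′ + m) → t + u ≡ t′ + u′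
    sizes-from-crosses {u = u} {u′ = u′} {m} z≤n z≤n 1≤m _ e =
      sym (*-cancelʳ-≡ u′ u m {{>-nonZero 1≤m}} (+-cancelˡ-≡ (u′ * u) _ _ (begin
        u′ * u + u′ * m   ≡⟨ *-distribˡ-+ u′ u m ⟨
        u′ * (u + m)      ≡⟨ e ⟩
        u * (u′ + m)      ≡⟨ *-distribˡ-+ u u′ m ⟩
        u * u′ + u * m    ≡⟨ cong (_+ u * m) (*-comm u u′) ⟩
        u′ * u + u * m    ∎)))
      where open ≡-Reasoning
    sizes-from-crosses (s≤s z≤n) (s≤s z≤n) _ e _ =
      +-cancelʳ-≡ 1 _ _ (trans (sym (*-identityˡ _)) (trans e (*-identityˡ _)))
    sizes-from-crosses {u = u} z≤n (s≤s z≤n) _ e _ =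
      ⊥-elim (1+n≢0 (trans (+-comm 1 u) (trans (sym (*-identityˡ (u + 1))) e)))
    sizes-from-crosses {u′ = u′} (s≤s z≤n) z≤n _ e _ =
      ⊥-elim (1+n≢0 (trans (+-comm 1 u′) (trans (sym (*-identityˡ (u′ + 1))) (sym e))))

  -- If x ∈ a then Jac a ⁅x⁆ = 1 − 1/∣a∣ < 1, otherwise Jac a ⁅x⁆ = 1 and Jac a (∁ ⁅x⁆) = 1 − ∣a∣/m.
  Jac⁅x⁆∧Jac∁⁅x⁆⇒∣∣≡ : ∀ {m} (x : Fin (suc m)) → 1 ≤ m → (a b : Subset (suc m)) →
                       Jac a ⁅ x ⁆ ≡ Jac b ⁅ x ⁆ → Jac a (∁ ⁅ x ⁆) ≡ Jac b (∁ ⁅ x ⁆) → ∣ a ∣ ≡ ∣ b ∣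
  Jac⁅x⁆∧Jac∁⁅x⁆⇒∣∣≡ {m} x 1≤m a b eq eq∁ = begin
    ∣ a ∣                                  ≡⟨ split a ⟨
    ∣ a ∩ ⁅ x ⁆ ∣ + ∣ a ∩ ∁ ⁅ x ⁆ ∣        ≡⟨ sizes-from-crosses (hit≤1 a) (hit≤1 b) 1≤m
                                                (cross-at ⁅ x ⁆ (∣⁅x⁆∣≡1 x) eq)
                                                (cross-at (∁ ⁅ x ⁆) ∣∁⁅x⁆∣≡m eq∁) ⟩
    ∣ b ∩ ⁅ x ⁆ ∣ + ∣ b ∩ ∁ ⁅ x ⁆ ∣        ≡⟨ split b ⟩
    ∣ b ∣                                  ∎
    where
    open ≡-Reasoning
    split : ∀ c → ∣ c ∩ ⁅ x ⁆ ∣ + ∣ c ∩ ∁ ⁅ x ⁆ ∣ ≡ ∣ c ∣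
    split c = ∣p∩q∣+∣p∩∁q∣≡∣p∣ c ⁅ x ⁆
    hit≤1 : ∀ c → ∣ c ∩ ⁅ x ⁆ ∣ ≤ 1
    hit≤1 c = ≤-trans (∣p∩q∣≤∣q∣ c ⁅ x ⁆) (≤-reflexive (∣⁅x⁆∣≡1 x))
    ∣∁⁅x⁆∣≡m : ∣ ∁ ⁅ x ⁆ ∣ ≡ m
    ∣∁⁅x⁆∣≡m = trans (∣∁p∣≡n∸∣p∣ ⁅ x ⁆) (cong (suc m ∸_) (∣⁅x⁆∣≡1 x))
    cross-at : ∀ r {k} → ∣ r ∣ ≡ k → Jac a r ≡ Jac b r →
               ∣ b ∩ r ∣ * (∣ a ∩ ⁅ x ⁆ ∣ + ∣ a ∩ ∁ ⁅ x ⁆ ∣ + k) ≡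
               ∣ a ∩ r ∣ * (∣ b ∩ ⁅ x ⁆ ∣ + ∣ b ∩ ∁ ⁅ x ⁆ ∣ + k)
    cross-at r refl e = subst₂ (λ A B → ∣ b ∩ r ∣ * (A + ∣ r ∣) ≡ ∣ a ∩ r ∣ * (B + ∣ r ∣))
                               (sym (split a)) (sym (split b)) (Jac≡⇒cross a b r e)

  -- Difference patterns

  data Tag : Set where
    inA inB same : Tag

  Diff : ℕ → Set
  Diff = Vec Tag

  diff : ∀ {n} → Subset n → Subset n → Diff n
  diff []          []          = []
  diff (true  ∷ a) (false ∷ b) = inA ∷ diff a b
  diff (false ∷ a) (true  ∷ b) = inB ∷ diff a b
  diff (true  ∷ a) (true  ∷ b) = same ∷ diff a b
  diff (false ∷ a) (false ∷ b) = same ∷ diff a b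

  -- Enumerating patterns rather than pairs (a, b) is what gives 3ⁿ rather than 4ⁿ in the union bound.
  allDiffs : ∀ n → List (Diff n)
  allDiffs zero    = [] ∷ []
  allDiffs (suc n) = map (inA ∷_) (allDiffs n) ++ map (inB ∷_) (allDiffs n) ++ map (same ∷_) (allDiffs n)

  length-allDiffs : ∀ n → length (allDiffs n) ≡ 3 ^ n
  length-allDiffs zero    = refl
  length-allDiffs (suc n) = begin
    length (map (inA ∷_) Ds ++ map (inB ∷_) Ds ++ map (same ∷_) Ds)
      ≡⟨ length-++ (map (inA ∷_) Ds) ⟩
    length (map (inA ∷_) Ds) + length (map (inB ∷_) Ds ++ map (same ∷_) Ds)
      ≡⟨ cong (length (map (inA ∷_) Ds) +_) (length-++ (map (inB ∷_) Ds)) ⟩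
    length (map (inA ∷_) Ds) + (length (map (inB ∷_) Ds) + length (map (same ∷_) Ds))
      ≡⟨ cong₂ _+_ (length-map (inA ∷_) Ds) (cong₂ _+_ (length-map (inB ∷_) Ds) (length-map (same ∷_) Ds)) ⟩
    length Ds + (length Ds + length Ds)
      ≡⟨ cong (λ m → m + (m + m)) (length-allDiffs n) ⟩
    3 ^ n + (3 ^ n + 3 ^ n)
      ≡⟨ cong (λ m → 3 ^ n + (3 ^ n + m)) (+-identityʳ (3 ^ n)) ⟨
    3 ^ suc n ∎
    where open ≡-Reasoning
          Ds = allDiffs n

  count-allDiffs-suc : ∀ n (p : Diff (suc n) → Bool) →
    count p (allDiffs (suc n)) ≡ count (p ∘ (inA ∷_)) (allDiffs n) + (count (p ∘ (inB ∷_)) (allDiffs n) + count (p ∘ (same ∷_)) (allDiffs n))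
  count-allDiffs-suc n p = begin
    count p (map (inA ∷_) Ds ++ map (inB ∷_) Ds ++ map (same ∷_) Ds)
      ≡⟨ count-++ p (map (inA ∷_) Ds) _ ⟩
    count p (map (inA ∷_) Ds) + count p (map (inB ∷_) Ds ++ map (same ∷_) Ds)
      ≡⟨ cong (count p (map (inA ∷_) Ds) +_) (count-++ p (map (inB ∷_) Ds) _) ⟩
    count p (map (inA ∷_) Ds) + (count p (map (inB ∷_) Ds) + count p (map (same ∷_) Ds))
      ≡⟨ cong₂ _+_ (count-map p (inA ∷_) Ds) (cong₂ _+_ (count-map p (inB ∷_) Ds) (count-map p (same ∷_) Ds)) ⟩
    count (p ∘ (inA ∷_)) Ds + (count (p ∘ (inB ∷_)) Ds + count (p ∘ (same ∷_)) Ds) ∎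
    where open ≡-Reasoning
          Ds = allDiffs n

  sizeA sizeB sizeΔ sizeSame : ∀ {n} → Diff n → ℕ
  sizeA []         = 0
  sizeA (inA ∷ d)  = suc (sizeA d)
  sizeA (_   ∷ d)  = sizeA d
  sizeB []         = 0
  sizeB (inB ∷ d)  = suc (sizeB d)
  sizeB (_   ∷ d)  = sizeB d
  sizeΔ []         = 0
  sizeΔ (same ∷ d) = sizeΔ d
  sizeΔ (_    ∷ d) = suc (sizeΔ d)
  sizeSame []         = 0
  sizeSame (same ∷ d) = suc (sizeSame d)
  sizeSame (_    ∷ d) = sizeSame d

  hitsA hitsB : ∀ {n} → Diff n → Subset n → ℕ
  hitsA []        []          = 0
  hitsA (inA ∷ d) (true ∷ r)  = suc (hitsA d r)
  hitsA (_   ∷ d) (_    ∷ r)  = hitsA d r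
  hitsB []        []          = 0
  hitsB (inB ∷ d) (true ∷ r)  = suc (hitsB d r)
  hitsB (_   ∷ d) (_    ∷ r)  = hitsB d r

  balanced : ∀ {n} → Diff n → Subset n → Bool
  balanced d r = hitsA d r ≡ᵇ hitsB d r

  -- score d r = ∣A ∩ r∣ + ∣B ∖ r∣ is binomially distributed, and r is balanced iff score d r = ∣B∣.
  score : ∀ {n} → Diff n → Subset n → ℕ
  score []         []          = 0
  score (inA  ∷ d) (true  ∷ r) = suc (score d r)
  score (inB  ∷ d) (false ∷ r) = suc (score d r)
  score (_    ∷ d) (_     ∷ r) = score d r

  sizeΔ≡sizeA+sizeB : ∀ {n} (d : Diff n) → sizeΔ d ≡ sizeA d + sizeB d
  sizeΔ≡sizeA+sizeB []         = refl
  sizeΔ≡sizeA+sizeB (inA  ∷ d) = cong suc (sizeΔ≡sizeA+sizeB d)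
  sizeΔ≡sizeA+sizeB (inB  ∷ d) = trans (cong suc (sizeΔ≡sizeA+sizeB d)) (sym (+-suc _ _))
  sizeΔ≡sizeA+sizeB (same ∷ d) = sizeΔ≡sizeA+sizeB d

  sizeΔ+sizeSame≡n : ∀ {n} (d : Diff n) → sizeΔ d + sizeSame d ≡ n
  sizeΔ+sizeSame≡n []         = refl
  sizeΔ+sizeSame≡n (inA  ∷ d) = cong suc (sizeΔ+sizeSame≡n d)
  sizeΔ+sizeSame≡n (inB  ∷ d) = cong suc (sizeΔ+sizeSame≡n d)
  sizeΔ+sizeSame≡n (same ∷ d) = trans (+-suc _ _) (cong suc (sizeΔ+sizeSame≡n d))

  score+hitsB≡hitsA+sizeB : ∀ {n} (d : Diff n) r → score d r + hitsB d r ≡ hitsA d r + sizeB d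
  score+hitsB≡hitsA+sizeB []         []          = refl
  score+hitsB≡hitsA+sizeB (inA  ∷ d) (true  ∷ r) = cong suc (score+hitsB≡hitsA+sizeB d r)
  score+hitsB≡hitsA+sizeB (inA  ∷ d) (false ∷ r) = score+hitsB≡hitsA+sizeB d r
  score+hitsB≡hitsA+sizeB (inB  ∷ d) (true  ∷ r) =
    trans (+-suc _ _) (trans (cong suc (score+hitsB≡hitsA+sizeB d r)) (sym (+-suc _ _)))
  score+hitsB≡hitsA+sizeB (inB  ∷ d) (false ∷ r) =
    trans (cong suc (score+hitsB≡hitsA+sizeB d r)) (sym (+-suc _ _))
  score+hitsB≡hitsA+sizeB (same ∷ d) (_     ∷ r) = score+hitsB≡hitsA+sizeB d r

  private
    pascal-step : ∀ w j o → (w C j) * 2 ^ o + (w C suc j) * 2 ^ o ≡ (suc w C suc j) * 2 ^ o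
    pascal-step w j o = trans (sym (*-distribʳ-+ (2 ^ o) (w C j) (w C suc j))) (cong (_* 2 ^ o) (nCk+nC[k+1]≡[n+1]C[k+1] w j))

  count-score : ∀ {n} (d : Diff n) j →
                count (λ r → score d r ≡ᵇ j) (allSubsets n) ≡ (sizeΔ d C j) * 2 ^ sizeSame d
  count-score []      zero    = refl
  count-score []      (suc j) = refl
  count-score {suc n} (t ∷ d) j = trans (count-allSubsets-suc n (λ r → score (t ∷ d) r ≡ᵇ j)) (by-tag t j)
    where
    S = allSubsets n
    #score : ℕ → ℕ
    #score k = count (λ r → score d r ≡ᵇ k) S
    none : count (λ r → suc (score d r) ≡ᵇ 0) S ≡ 0
    none = count-const false S
    by-tag : ∀ t j → count (λ r → score (t ∷ d) (true ∷ r) ≡ᵇ j) S + count (λ r → score (t ∷ d) (false ∷ r) ≡ᵇ j) S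
                     ≡ (sizeΔ (t ∷ d) C j) * 2 ^ sizeSame (t ∷ d)
    by-tag inA zero    = trans (cong (_+ #score 0) none) (count-score d zero)
    by-tag inA (suc j) = trans (cong₂ _+_ (count-score d j) (count-score d (suc j))) (pascal-step (sizeΔ d) j (sizeSame d))
    by-tag inB zero    = trans (cong (#score 0 +_) none) (trans (+-identityʳ _) (count-score d zero))
    by-tag inB (suc j) = trans (+-comm (#score (suc j)) (#score j))
      (trans (cong₂ _+_ (count-score d j) (count-score d (suc j))) (pascal-step (sizeΔ d) j (sizeSame d)))
    by-tag same j = trans (cong₂ _+_ (count-score d j) (count-score d j)) (double (sizeΔ d C j) (2 ^ sizeSame d))
      where double : ∀ c p → c * p + c * p ≡ c * (2 * p)
            double = solve-∀

  #balanced : ∀ {n} → Diff n → ℕ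
  #balanced {n} d = count (balanced d) (allSubsets n)

  #balanced≡ : ∀ {n} (d : Diff n) → #balanced d ≡ (sizeΔ d C sizeB d) * 2 ^ sizeSame d
  #balanced≡ {n} d = trans (count-cong balanced⇒score score⇒balanced (allSubsets n)) (count-score d (sizeB d))
    where
    balanced⇒score : ∀ r → T (balanced d r) → T (score d r ≡ᵇ sizeB d)
    balanced⇒score r eq = ≡⇒≡ᵇ _ _ (+-cancelʳ-≡ (hitsB d r) _ _ (begin
      score d r + hitsB d r    ≡⟨ score+hitsB≡hitsA+sizeB d r ⟩
      hitsA d r + sizeB d      ≡⟨ cong (_+ sizeB d) (≡ᵇ⇒≡ _ _ eq) ⟩
      hitsB d r + sizeB d      ≡⟨ +-comm (hitsB d r) (sizeB d) ⟩
      sizeB d + hitsB d r      ∎))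
      where open ≡-Reasoning
    score⇒balanced : ∀ r → T (score d r ≡ᵇ sizeB d) → T (balanced d r)
    score⇒balanced r eq = ≡⇒≡ᵇ _ _ (+-cancelʳ-≡ (sizeB d) _ _ (begin
      hitsA d r + sizeB d      ≡⟨ score+hitsB≡hitsA+sizeB d r ⟨
      score d r + hitsB d r    ≡⟨ cong (_+ hitsB d r) (≡ᵇ⇒≡ _ _ eq) ⟩
      sizeB d + hitsB d r      ≡⟨ +-comm (sizeB d) (hitsB d r) ⟩
      hitsB d r + sizeB d      ∎))
      where open ≡-Reasoning

  #balanced-bound : ∀ {n} (d : Diff n) {s} → sizeA d ≡ s → sizeB d ≡ s →
                    #balanced d * #balanced d * suc (2 * s) ≤ 4 ^ n
  #balanced-bound {n} d {s} refl sB≡s = begin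
    #balanced d * #balanced d * suc (2 * s)       ≡⟨ cong (λ c → c * c * suc (2 * s)) (trans (#balanced≡ d) (cong₂ (λ w j → (w C j) * 2 ^ o) sizeΔ≡2s sB≡s)) ⟩
    central s * 2 ^ o * (central s * 2 ^ o) * suc (2 * s) ≡⟨ regroup (central s) (2 ^ o) (suc (2 * s)) ⟩
    central s * central s * suc (2 * s) * (2 ^ o * 2 ^ o) ≤⟨ *-mono-≤ (central-bound s) (≤-reflexive (sym (^-distribˡ-+-* 2 o o))) ⟩
    16 ^ s * 2 ^ (o + o)                          ≡⟨ powers s o ⟩
    4 ^ (2 * s + o)                               ≡⟨ cong (λ w → 4 ^ (w + o)) sizeΔ≡2s ⟨
    4 ^ (sizeΔ d + o)                             ≡⟨ cong (4 ^_) (sizeΔ+sizeSame≡n d) ⟩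
    4 ^ n                                         ∎
    where
    open ≤-Reasoning
    o = sizeSame d
    sizeΔ≡2s : sizeΔ d ≡ 2 * sizeA d
    sizeΔ≡2s = trans (sizeΔ≡sizeA+sizeB d) (cong (sizeA d +_) (trans sB≡s (sym (+-identityʳ _))))
    regroup : ∀ c p w → c * p * (c * p) * w ≡ c * c * w * (p * p)
    regroup = solve-∀
    powers : ∀ s o → 16 ^ s * 2 ^ (o + o) ≡ 4 ^ (2 * s + o)
    powers s o = begin-equality
      16 ^ s * 2 ^ (o + o)        ≡⟨ cong₂ _*_ (^-*-assoc 4 2 s) (^-distribˡ-+-* 2 o o) ⟩
      4 ^ (2 * s) * (2 ^ o * 2 ^ o) ≡⟨ cong (4 ^ (2 * s) *_) (^-distribʳ-* 2 2 o) ⟨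
      4 ^ (2 * s) * 4 ^ o          ≡⟨ ^-distribˡ-+-* 4 (2 * s) o ⟨
      4 ^ (2 * s + o)              ∎

  #small-diffs≤ : ∀ n S → count (λ d → sizeΔ d <ᵇ S) (allDiffs n) ≤ suc (2 * n) ^ S
  #small-diffs≤ zero    zero    = z≤n
  #small-diffs≤ zero    (suc S) = ≤-reflexive (sym (^-zeroˡ (suc S)))
  #small-diffs≤ (suc n) zero    = ≤-trans (≤-reflexive (count-const false (allDiffs (suc n)))) z≤n
  #small-diffs≤ (suc n) (suc S) = begin
    count (λ d → sizeΔ d <ᵇ suc S) (allDiffs (suc n))
      ≡⟨ count-allDiffs-suc n (λ d → sizeΔ d <ᵇ suc S) ⟩
    #small S + (#small S + #small (suc S))
      ≤⟨ +-mono-≤ (#small-diffs≤ n S) (+-mono-≤ (#small-diffs≤ n S) (#small-diffs≤ n (suc S))) ⟩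
    x ^ S + (x ^ S + x * x ^ S)
      ≡⟨ collect x (x ^ S) ⟩
    (2 + x) * x ^ S
      ≤⟨ *-monoʳ-≤ (2 + x) (^-monoˡ-≤ S (m≤n+m x 2)) ⟩
    (2 + x) * (2 + x) ^ S
      ≡⟨ cong (λ y → y * y ^ S) (2+x≡ n) ⟩
    suc (2 * suc n) ^ suc S ∎
    where
    open ≤-Reasoning
    x = suc (2 * n)
    #small : ℕ → ℕ
    #small S = count (λ d → sizeΔ d <ᵇ S) (allDiffs n)
    collect : ∀ x y → y + (y + x * y) ≡ (2 + x) * y
    collect = solve-∀
    2+x≡ : ∀ n → 2 + suc (2 * n) ≡ suc (2 * suc n)
    2+x≡ = solve-∀

  hitsA-diff : ∀ {n} (a b r : Subset n) → hitsA (diff a b) r + ∣ (a ∩ b) ∩ r ∣ ≡ ∣ a ∩ r ∣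
  hitsA-diff []          []          []          = refl
  hitsA-diff (true  ∷ a) (false ∷ b) (true  ∷ r) = cong suc (hitsA-diff a b r)
  hitsA-diff (true  ∷ a) (false ∷ b) (false ∷ r) = hitsA-diff a b r
  hitsA-diff (false ∷ a) (true  ∷ b) (_     ∷ r) = hitsA-diff a b r
  hitsA-diff (true  ∷ a) (true  ∷ b) (true  ∷ r) = trans (+-suc _ _) (cong suc (hitsA-diff a b r))
  hitsA-diff (true  ∷ a) (true  ∷ b) (false ∷ r) = hitsA-diff a b r
  hitsA-diff (false ∷ a) (false ∷ b) (_     ∷ r) = hitsA-diff a b r

  hitsB-diff : ∀ {n} (a b r : Subset n) → hitsB (diff a b) r + ∣ (a ∩ b) ∩ r ∣ ≡ ∣ b ∩ r ∣
  hitsB-diff []          []          []          = refl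
  hitsB-diff (false ∷ a) (true  ∷ b) (true  ∷ r) = cong suc (hitsB-diff a b r)
  hitsB-diff (false ∷ a) (true  ∷ b) (false ∷ r) = hitsB-diff a b r
  hitsB-diff (true  ∷ a) (false ∷ b) (_     ∷ r) = hitsB-diff a b r
  hitsB-diff (true  ∷ a) (true  ∷ b) (true  ∷ r) = trans (+-suc _ _) (cong suc (hitsB-diff a b r))
  hitsB-diff (true  ∷ a) (true  ∷ b) (false ∷ r) = hitsB-diff a b r
  hitsB-diff (false ∷ a) (false ∷ b) (_     ∷ r) = hitsB-diff a b r

  sizeA-diff : ∀ {n} (a b : Subset n) → sizeA (diff a b) + ∣ a ∩ b ∣ ≡ ∣ a ∣
  sizeA-diff []          []          = refl
  sizeA-diff (true  ∷ a) (false ∷ b) = cong suc (sizeA-diff a b)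
  sizeA-diff (false ∷ a) (true  ∷ b) = sizeA-diff a b
  sizeA-diff (true  ∷ a) (true  ∷ b) = trans (+-suc _ _) (cong suc (sizeA-diff a b))
  sizeA-diff (false ∷ a) (false ∷ b) = sizeA-diff a b

  sizeB-diff : ∀ {n} (a b : Subset n) → sizeB (diff a b) + ∣ a ∩ b ∣ ≡ ∣ b ∣
  sizeB-diff []          []          = refl
  sizeB-diff (false ∷ a) (true  ∷ b) = cong suc (sizeB-diff a b)
  sizeB-diff (true  ∷ a) (false ∷ b) = sizeB-diff a b
  sizeB-diff (true  ∷ a) (true  ∷ b) = trans (+-suc _ _) (cong suc (sizeB-diff a b))
  sizeB-diff (false ∷ a) (false ∷ b) = sizeB-diff a b

  sizeA≡0⇒sizeB≡0⇒≡ : ∀ {n} (a b : Subset n) → sizeA (diff a b) ≡ 0 → sizeB (diff a b) ≡ 0 → a ≡ b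
  sizeA≡0⇒sizeB≡0⇒≡ []          []          _  _  = refl
  sizeA≡0⇒sizeB≡0⇒≡ (true  ∷ a) (false ∷ b) () _
  sizeA≡0⇒sizeB≡0⇒≡ (false ∷ a) (true  ∷ b) _  ()
  sizeA≡0⇒sizeB≡0⇒≡ (true  ∷ a) (true  ∷ b) eA eB = cong (true ∷_) (sizeA≡0⇒sizeB≡0⇒≡ a b eA eB)
  sizeA≡0⇒sizeB≡0⇒≡ (false ∷ a) (false ∷ b) eA eB = cong (false ∷_) (sizeA≡0⇒sizeB≡0⇒≡ a b eA eB)

  ∈-allDiffs : ∀ {n} (d : Diff n) → d ∈ allDiffs n
  ∈-allDiffs []        = here refl
  ∈-allDiffs {suc n} (inA  ∷ d) = ∈-++⁺ˡ (∈-map⁺ (inA ∷_) (∈-allDiffs d))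
  ∈-allDiffs {suc n} (inB  ∷ d) = ∈-++⁺ʳ (map (inA ∷_) (allDiffs n)) (∈-++⁺ˡ (∈-map⁺ (inB ∷_) (∈-allDiffs d)))
  ∈-allDiffs {suc n} (same ∷ d) = ∈-++⁺ʳ (map (inA ∷_) (allDiffs n)) (∈-++⁺ʳ (map (inB ∷_) (allDiffs n)) (∈-map⁺ (same ∷_) (∈-allDiffs d)))

  -- Exactly the patterns diff a b of pairs a ≢ b with ∣a∣ ≡ ∣b∣.
  admissible : ∀ {n} → Diff n → Bool
  admissible d = (sizeA d ≡ᵇ sizeB d) ∧ (0 <ᵇ sizeA d)

  admissible-sizes : ∀ {n} (d : Diff n) → admissible d ≡ true → sizeB d ≡ sizeA d × 0 < sizeA d
  admissible-sizes d eq with Equivalence.to T-∧ (Equivalence.from T-≡ eq)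
  ... | A≡B , A>0 = sym (≡ᵇ⇒≡ _ _ A≡B) , <ᵇ⇒< 0 (sizeA d) A>0

  undetected : ∀ {n k} → Diff n → Vec (Subset n) k → Bool
  undetected d rs = admissible d ∧ all (balanced d) (toList rs)

  detectsAll : ∀ {n k} → Vec (Subset n) k → Bool
  detectsAll {n} rs = not (any (λ d → undetected d rs) (allDiffs n))

  detectsAll⇒resolves : ∀ {m k} (x : Fin (suc m)) → 1 ≤ m → (rs : Vec (Subset (suc m)) k) →
                        T (detectsAll rs) → Resolves (familyR x rs)
  detectsAll⇒resolves x 1≤m rs detects a b (_ ∷ eq⁅x⁆ ∷ eq∁⁅x⁆ ∷ eqs) with ≡-dec _≟ᵇ_ a b
  ... | yes a≡b = a≡b
  ... | no  a≢b = ⊥-elim (subst T (Equivalence.to T-not-≡ detects)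
                                 (any⁺ _ (lose (∈-allDiffs (diff a b)) fooled)))
    where
    ∣a∣≡∣b∣ : ∣ a ∣ ≡ ∣ b ∣
    ∣a∣≡∣b∣ = Jac⁅x⁆∧Jac∁⁅x⁆⇒∣∣≡ x 1≤m a b eq⁅x⁆ eq∁⁅x⁆
    sizeA≡sizeB : sizeA (diff a b) ≡ sizeB (diff a b)
    sizeA≡sizeB = +-cancelʳ-≡ ∣ a ∩ b ∣ _ _ (trans (sizeA-diff a b) (trans ∣a∣≡∣b∣ (sym (sizeB-diff a b))))
    sizeA>0 : 0 < sizeA (diff a b)
    sizeA>0 with sizeA (diff a b) in e
    ... | zero  = ⊥-elim (a≢b (sizeA≡0⇒sizeB≡0⇒≡ a b e (trans (sym sizeA≡sizeB) e)))
    ... | suc _ = s≤s z≤n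
    balanced-at : ∀ {r} → Jac a r ≡ Jac b r → T (balanced (diff a b) r)
    balanced-at {r} eq = ≡⇒≡ᵇ _ _ (+-cancelʳ-≡ ∣ (a ∩ b) ∩ r ∣ _ _
      (trans (hitsA-diff a b r) (trans (Jac≡⇒∣∩∣≡ a b r ∣a∣≡∣b∣ eq) (sym (hitsB-diff a b r)))))
    fooled : T (undetected (diff a b) rs)
    fooled = Equivalence.from T-∧ (Equivalence.from T-∧ (≡⇒≡ᵇ _ _ sizeA≡sizeB , <⇒<ᵇ sizeA>0) ,
                                   all⁻ _ (All.map balanced-at eqs))

  undetectedWeight : ∀ {n} → ℕ → Diff n → ℕ
  undetectedWeight k d = if admissible d then #balanced d ^ k else 0

  count-undetected : ∀ {n} k (d : Diff n) → count (undetected d) (allTuples n k) ≡ undetectedWeight k d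
  count-undetected {n} k d = trans (count-const∧ (admissible d) (all (balanced d) ∘ toList) (allTuples n k))
                                   (cong (if admissible d then_else 0) (count-allTuples n k (balanced d)))

  #resolving : ∀ {n} → ℕ → Fin n → ℕ
  #resolving {n} k x = length (filter (resolves? ∘ familyR x) (allTuples n k))

  #resolving+#undetected≥2^[nk] : ∀ {m} k (x : Fin (suc m)) → 1 ≤ m →
    2 ^ (suc m * k) ≤ #resolving k x + sum (map (undetectedWeight k) (allDiffs (suc m)))
  #resolving+#undetected≥2^[nk] {m} k x 1≤m = begin
    2 ^ (n * k)                                                ≡⟨ length-allTuples n k ⟨
    length Rs                                                  ≡⟨ count+count-not detectsAll Rs ⟨
    count detectsAll Rs + count (not ∘ detectsAll) Rs
      ≤⟨ +-mono-≤ (count-mono (λ rs → Equivalence.from T-≡ ∘ dec-true (resolves? (familyR x rs))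
                                                ∘ detectsAll⇒resolves x 1≤m rs) Rs)
                  (count-mono {p = not ∘ detectsAll} (λ _ → subst T (not-involutive _)) Rs) ⟩
    count (does ∘ resolves? ∘ familyR x) Rs + count (λ rs → any (λ d → undetected d rs) (allDiffs n)) Rs
      ≤⟨ +-monoʳ-≤ _ (count-any≤sum undetected (allDiffs n) Rs) ⟩
    count (does ∘ resolves? ∘ familyR x) Rs + sum (map (λ d → count (undetected d) Rs) (allDiffs n))
      ≡⟨ cong₂ _+_ (sym (length-filter≡count (resolves? ∘ familyR x) Rs))
                   (cong sum (map-cong (count-undetected k) (allDiffs n))) ⟩
    length (filter (resolves? ∘ familyR x) Rs) + sum (map (undetectedWeight k) (allDiffs n)) ∎
    where
    open ≤-Reasoning
    n = suc m
    Rs = allTuples n k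

  weighted-power-bound : ∀ n k c w P → c * c * w ≤ 4 ^ n → P * P ≤ w ^ k → P * c ^ k ≤ 2 ^ (n * k)
  weighted-power-bound n k c w P c²w≤4ⁿ P²≤wᵏ = ^-cancelˡ-≤ 1 (begin
    (P * c ^ k) ^ 2            ≡⟨ square P (c ^ k) ⟩
    P * P * (c ^ k * c ^ k)    ≡⟨ cong (P * P *_) (^-distribʳ-* c c k) ⟨
    P * P * (c * c) ^ k        ≤⟨ *-monoˡ-≤ ((c * c) ^ k) P²≤wᵏ ⟩
    w ^ k * (c * c) ^ k        ≡⟨ ^-distribʳ-* w (c * c) k ⟨
    (w * (c * c)) ^ k          ≤⟨ ^-monoˡ-≤ k (≤-trans (≤-reflexive (*-comm w (c * c))) c²w≤4ⁿ) ⟩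
    (4 ^ n) ^ k                ≡⟨ ^-*-assoc 4 n k ⟩
    4 ^ (n * k)                ≡⟨ ^-distribʳ-* 2 2 (n * k) ⟩
    2 ^ (n * k) * 2 ^ (n * k)  ≡⟨ cong (2 ^ (n * k) *_) (*-identityʳ (2 ^ (n * k))) ⟨
    (2 ^ (n * k)) ^ 2          ∎)
    where
    open ≤-Reasoning
    square : ∀ x y → x * y * (x * y * 1) ≡ x * x * (y * y)
    square = solve-∀

  undetectedWeight-large : ∀ {n} k D K (d : Diff n) → K * K ≤ D ^ k → D ≤ sizeA d →
                           undetectedWeight k d * K ≤ 2 ^ (n * k)
  undetectedWeight-large {n} k D K d K²≤Dᵏ D≤A with admissible d in adm
  ... | false = z≤n
  ... | true  = ≤-trans (≤-reflexive (*-comm (#balanced d ^ k) K))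
    (weighted-power-bound n k (#balanced d) (suc (2 * sizeA d)) K
      (#balanced-bound d refl (proj₁ (admissible-sizes d adm)))
      (≤-trans K²≤Dᵏ (^-monoˡ-≤ k (≤-trans D≤A (≤-trans (m≤m+n (sizeA d) _) (n≤1+n _))))))

  undetectedWeight-small : ∀ {n} k D K (d : Diff n) → K * K ≤ 3 ^ k → sizeA d < D →
                           undetectedWeight k d * K ≤ (if sizeΔ d <ᵇ 2 * D then 2 ^ (n * k) else 0)
  undetectedWeight-small {n} k D K d K²≤3ᵏ A<D with admissible d in adm
  ... | false = z≤n
  ... | true  = subst (λ b → #balanced d ^ k * K ≤ (if b then 2 ^ (n * k) else 0))
                      (sym (Equivalence.to T-≡ (<⇒<ᵇ Δ<2D)))
    (≤-trans (≤-reflexive (*-comm (#balanced d ^ k) K))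
      (weighted-power-bound n k (#balanced d) 3 K
        (≤-trans (*-monoʳ-≤ (#balanced d * #balanced d) (s≤s (*-monoʳ-≤ 2 A>0))) (#balanced-bound d refl B≡A))
        K²≤3ᵏ))
    where
    B≡A = proj₁ (admissible-sizes d adm)
    A>0 = proj₂ (admissible-sizes d adm)
    Δ<2D : sizeΔ d < 2 * D
    Δ<2D = subst (_< 2 * D) (sym (trans (sizeΔ≡sizeA+sizeB d) (cong (sizeA d +_) (trans B≡A (sym (+-identityʳ _))))))
                 (*-monoʳ-< 2 A<D)

  undetected-large-sum : ∀ n k M D → (2 * M * 3 ^ n) * (2 * M * 3 ^ n) ≤ D ^ k →
    2 * M * sum (map (λ d → if D ≤ᵇ sizeA d then undetectedWeight k d else 0) (allDiffs n)) ≤ 2 ^ (n * k)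
  undetected-large-sum n k M D K²≤Dᵏ = *-cancelˡ-≤ (3 ^ n) {{m^n≢0 3 n}} (begin
    3 ^ n * (2 * M * Σlarge)         ≡⟨ rotate (3 ^ n) (2 * M) Σlarge ⟩
    Σlarge * K                       ≤⟨ sum*≤count* large (λ _ → true) bound Ds ⟩
    count (λ _ → true) Ds * Ω   ≡⟨ cong (_* Ω) (trans (count-const true Ds) (length-allDiffs n)) ⟩
    3 ^ n * Ω                   ∎)
    where
    open ≤-Reasoning
    Ω = 2 ^ (n * k)
    Ds = allDiffs n
    K = 2 * M * 3 ^ n
    large : Diff n → ℕ
    large d = if D ≤ᵇ sizeA d then undetectedWeight k d else 0
    Σlarge = sum (map large Ds)
    rotate : ∀ a b c → a * (b * c) ≡ c * (b * a)
    rotate = solve-∀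
    bound : ∀ d → large d * K ≤ Ω
    bound d with D ≤ᵇ sizeA d in isLarge
    ... | true  = undetectedWeight-large k D K d K²≤Dᵏ (≤ᵇ⇒≤ D (sizeA d) (Equivalence.from T-≡ isLarge))
    ... | false = z≤n

  undetected-small-sum : ∀ n k M D → (2 * M * suc (2 * n) ^ (2 * D)) * (2 * M * suc (2 * n) ^ (2 * D)) ≤ 3 ^ k →
    2 * M * sum (map (λ d → if D ≤ᵇ sizeA d then 0 else undetectedWeight k d) (allDiffs n)) ≤ 2 ^ (n * k)
  undetected-small-sum n k M D K²≤3ᵏ = *-cancelˡ-≤ (suc (2 * n) ^ (2 * D)) {{m^n≢0 (suc (2 * n)) (2 * D)}} (begin
    suc (2 * n) ^ (2 * D) * (2 * M * Σsmall)     ≡⟨ rotate (suc (2 * n) ^ (2 * D)) (2 * M) Σsmall ⟩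
    Σsmall * K                                   ≤⟨ sum*≤count* small (λ d → sizeΔ d <ᵇ 2 * D) bound Ds ⟩
    count (λ d → sizeΔ d <ᵇ 2 * D) Ds * Ω   ≤⟨ *-monoˡ-≤ Ω (#small-diffs≤ n (2 * D)) ⟩
    suc (2 * n) ^ (2 * D) * Ω               ∎)
    where
    open ≤-Reasoning
    Ω = 2 ^ (n * k)
    Ds = allDiffs n
    K = 2 * M * suc (2 * n) ^ (2 * D)
    small : Diff n → ℕ
    small d = if D ≤ᵇ sizeA d then 0 else undetectedWeight k d
    Σsmall = sum (map small Ds)
    rotate : ∀ a b c → a * (b * c) ≡ c * (b * a)
    rotate = solve-∀
    bound : ∀ d → small d * K ≤ (if sizeΔ d <ᵇ 2 * D then Ω else 0)
    bound d with D ≤ᵇ sizeA d in isLarge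
    ... | true  = z≤n
    ... | false = undetectedWeight-small k D K d K²≤3ᵏ (≰⇒> (λ D≤A → subst T isLarge (≤⇒≤ᵇ D≤A)))

  undetected-sum-bound : ∀ n k M D →
    (2 * M * 3 ^ n) * (2 * M * 3 ^ n) ≤ D ^ k →
    (2 * M * suc (2 * n) ^ (2 * D)) * (2 * M * suc (2 * n) ^ (2 * D)) ≤ 3 ^ k →
    M * sum (map (undetectedWeight k) (allDiffs n)) ≤ 2 ^ (n * k)
  undetected-sum-bound n k M D K₁²≤Dᵏ K₂²≤3ᵏ = *-cancelˡ-≤ 2 (begin
    2 * (M * sum (map w Ds))            ≡⟨ cong (λ s → 2 * (M * s)) (trans (cong sum (map-cong split Ds)) (sum-map-+ large small Ds)) ⟩
    2 * (M * (Σlarge + Σsmall))         ≡⟨ distribute M Σlarge Σsmall ⟩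
    2 * M * Σlarge + 2 * M * Σsmall     ≤⟨ +-mono-≤ (undetected-large-sum n k M D K₁²≤Dᵏ) (undetected-small-sum n k M D K₂²≤3ᵏ) ⟩
    Ω + Ω                               ≡⟨ cong (Ω +_) (+-identityʳ Ω) ⟨
    2 * Ω                               ∎)
    where
    open ≤-Reasoning
    Ω = 2 ^ (n * k)
    Ds = allDiffs n
    w = undetectedWeight k
    large small : Diff n → ℕ
    large d = if D ≤ᵇ sizeA d then w d else 0
    small d = if D ≤ᵇ sizeA d then 0 else w d
    Σlarge = sum (map large Ds)
    Σsmall = sum (map small Ds)
    split : ∀ d → w d ≡ large d + small d
    split d with D ≤ᵇ sizeA d
    ... | true  = sym (+-identityʳ (w d))
    ... | false = refl
    distribute : ∀ M a b → 2 * (M * (a + b)) ≡ 2 * M * a + 2 * M * b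
    distribute = solve-∀

  2⁹*[2M*3ⁿ]²⁰≤[2⁴ⁿ]⁹ : ∀ M n → 2 ^ 9 * (2 * M) ^ 20 ≤ n → 2 ^ 9 * (2 * M * 3 ^ n) ^ 20 ≤ (2 ^ (4 * n)) ^ 9
  2⁹*[2M*3ⁿ]²⁰≤[2⁴ⁿ]⁹ M n M-small = begin
    2 ^ 9 * (2 * M * 3 ^ n) ^ 20         ≡⟨ cong (2 ^ 9 *_) (^-distribʳ-* (2 * M) (3 ^ n) 20) ⟩
    2 ^ 9 * ((2 * M) ^ 20 * (3 ^ n) ^ 20) ≡⟨ *-assoc (2 ^ 9) ((2 * M) ^ 20) ((3 ^ n) ^ 20) ⟨
    2 ^ 9 * (2 * M) ^ 20 * (3 ^ n) ^ 20   ≤⟨ *-monoˡ-≤ ((3 ^ n) ^ 20) (≤-trans M-small (<⇒≤ (n<2^n n))) ⟩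
    2 ^ n * (3 ^ n) ^ 20                 ≡⟨ cong (2 ^ n *_) (^-swap 3 n 20) ⟩
    2 ^ n * (3 ^ 20) ^ n                 ≡⟨ ^-distribʳ-* 2 (3 ^ 20) n ⟨
    (2 * 3 ^ 20) ^ n                     ≤⟨ ^-monoˡ-≤ n (≤ᵇ⇒≤ (2 * 3 ^ 20) (2 ^ 36) _) ⟩
    (2 ^ 36) ^ n                         ≡⟨ trans (^-*-assoc 2 36 n) (cong (2 ^_) (regroup n)) ⟩
    2 ^ (4 * n * 9)                      ≡⟨ ^-*-assoc 2 (4 * n) 9 ⟨
    (2 ^ (4 * n)) ^ 9                    ∎
    where
    open ≤-Reasoning
    regroup : ∀ n → 36 * n ≡ 4 * n * 9
    regroup = solve-∀

  large-threshold : ∀ n k M D → 2 ^ 9 * (2 * M) ^ 20 ≤ n → n ^ 9 ≤ D ^ 10 →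
                    2 ^ (4 * n) * 2 ^ k ≤ 2 * n ^ k →
                    (2 * M * 3 ^ n) * (2 * M * 3 ^ n) ≤ D ^ k
  large-threshold n k M D M-small n⁹≤D¹⁰ H = ^-cancelˡ-≤ 9 (*-cancelˡ-≤ (2 ^ 9) (begin
    2 ^ 9 * (P * P) ^ 10         ≡⟨ cong (2 ^ 9 *_) (trans (^-distribʳ-* P P 10) (sym (^-distribˡ-+-* P 10 10))) ⟩
    2 ^ 9 * P ^ 20               ≤⟨ 2⁹*[2M*3ⁿ]²⁰≤[2⁴ⁿ]⁹ M n M-small ⟩
    (2 ^ (4 * n)) ^ 9            ≤⟨ ^-monoˡ-≤ 9 (m≤m*n (2 ^ (4 * n)) (2 ^ k) {{m^n≢0 2 k}}) ⟩
    (2 ^ (4 * n) * 2 ^ k) ^ 9    ≤⟨ ^-monoˡ-≤ 9 H ⟩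
    (2 * n ^ k) ^ 9              ≡⟨ ^-distribʳ-* 2 (n ^ k) 9 ⟩
    2 ^ 9 * (n ^ k) ^ 9          ≡⟨ cong (2 ^ 9 *_) (^-swap n k 9) ⟩
    2 ^ 9 * (n ^ 9) ^ k          ≤⟨ *-monoʳ-≤ (2 ^ 9) (^-monoˡ-≤ k n⁹≤D¹⁰) ⟩
    2 ^ 9 * (D ^ 10) ^ k         ≡⟨ cong (2 ^ 9 *_) (^-swap D 10 k) ⟩
    2 ^ 9 * (D ^ k) ^ 10         ∎))
    where
    open ≤-Reasoning
    P = 2 * M * 3 ^ n

  small-threshold : ∀ n k M D L → n < 2 ^ suc L → 4 * M + 4 * D * (2 + L) ≤ k →
                    (2 * M * suc (2 * n) ^ (2 * D)) * (2 * M * suc (2 * n) ^ (2 * D)) ≤ 3 ^ k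
  small-threshold n k M D L n<2^[1+L] exponent≤k = begin
    K * K                    ≤⟨ *-mono-≤ K≤2^e K≤2^e ⟩
    2 ^ e * 2 ^ e            ≡⟨ ^-distribˡ-+-* 2 e e ⟨
    2 ^ (e + e)              ≡⟨ cong (2 ^_) (double M D L) ⟩
    2 ^ (4 * M + 4 * D * (2 + L)) ≤⟨ ^-monoʳ-≤ 2 exponent≤k ⟩
    2 ^ k                    ≤⟨ ^-monoˡ-≤ k (n≤1+n 2) ⟩
    3 ^ k                    ∎
    where
    open ≤-Reasoning
    K = 2 * M * suc (2 * n) ^ (2 * D)
    e = 2 * M + (2 + L) * (2 * D)
    double : ∀ M D L → 2 * M + (2 + L) * (2 * D) + (2 * M + (2 + L) * (2 * D)) ≡ 4 * M + 4 * D * (2 + L)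
    double = solve-∀
    1+2n≤2^[2+L] : suc (2 * n) ≤ 2 ^ (2 + L)
    1+2n≤2^[2+L] = ≤-trans (n≤1+n _) (≤-trans (≤-reflexive (cong suc (sym (+-suc n (n + 0))))) (*-monoʳ-≤ 2 n<2^[1+L]))
    K≤2^e : K ≤ 2 ^ e
    K≤2^e = begin
      2 * M * suc (2 * n) ^ (2 * D)          ≤⟨ *-mono-≤ (<⇒≤ (n<2^n (2 * M))) (^-monoˡ-≤ (2 * D) 1+2n≤2^[2+L]) ⟩
      2 ^ (2 * M) * (2 ^ (2 + L)) ^ (2 * D)  ≡⟨ cong (2 ^ (2 * M) *_) (^-*-assoc 2 (2 + L) (2 * D)) ⟩
      2 ^ (2 * M) * 2 ^ ((2 + L) * (2 * D))  ≡⟨ ^-distribˡ-+-* 2 (2 * M) _ ⟨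
      2 ^ e                                  ∎

  binary-magnitude : ∀ n → 1 ≤ n → Σ ℕ λ L → 2 ^ L ≤ n × n < 2 ^ suc L
  binary-magnitude (suc zero)    _ = 0 , s≤s z≤n , s≤s (s≤s z≤n)
  binary-magnitude (suc (suc n)) _ with binary-magnitude (suc n) (s≤s z≤n)
  ... | L , lower , upper with suc (suc n) <? 2 ^ suc L
  ...   | yes below = L , m≤n⇒m≤1+n lower , below
  ...   | no  ¬below = suc L , ≮⇒≥ ¬below , (begin-strict
    suc (suc n)          ≡⟨ 2^[1+L]≡2+n ⟨
    2 ^ suc L            <⟨ m<m+n (2 ^ suc L) (m^n>0 2 (suc L)) ⟩
    2 ^ suc L + 2 ^ suc L ≡⟨ cong (2 ^ suc L +_) (+-identityʳ (2 ^ suc L)) ⟨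
    2 ^ suc (suc L)      ∎)
    where
    open ≤-Reasoning
    2^[1+L]≡2+n : 2 ^ suc L ≡ suc (suc n)
    2^[1+L]≡2+n = ≤-antisym (≮⇒≥ ¬below) upper

  n≤L*k : ∀ n k L → 1 ≤ n → n < 2 ^ suc L → 2 ^ (4 * n) * 2 ^ k ≤ 2 * n ^ k → n ≤ L * k
  n≤L*k n k L 1≤n n<2^[1+L] H = ≤-pred (≤-trans 1+n≤4n (+-cancelʳ-≤ k _ _ exponents))
    where
    open ≤-Reasoning
    exponents : 4 * n + k ≤ 1 + L * k + k
    exponents = ^-cancelʳ-≤ 2 (s≤s (s≤s z≤n)) (begin
      2 ^ (4 * n + k)          ≡⟨ ^-distribˡ-+-* 2 (4 * n) k ⟩
      2 ^ (4 * n) * 2 ^ k      ≤⟨ H ⟩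
      2 * n ^ k                ≤⟨ *-monoʳ-≤ 2 (^-monoˡ-≤ k (<⇒≤ n<2^[1+L])) ⟩
      2 * (2 ^ suc L) ^ k      ≡⟨ cong (2 *_) (^-*-assoc 2 (suc L) k) ⟩
      2 ^ (1 + suc L * k)      ≡⟨ cong (2 ^_) (regroup L k) ⟩
      2 ^ (1 + L * k + k)      ∎)
      where regroup : ∀ L k → 1 + suc L * k ≡ 1 + L * k + k
            regroup = solve-∀
    1+n≤4n : suc n ≤ 4 * n
    1+n≤4n = ≤-trans (≤-reflexive (+-comm 1 n)) (≤-trans (+-monoʳ-≤ n (≤-trans 1≤n (m≤m*n n 3))) (≤-reflexive (regroup n)))
      where regroup : ∀ n → n + n * 3 ≡ 4 * n
            regroup = solve-∀

  [2+q]²≤2*[1+q]² : ∀ q → 2 ≤ q → suc (suc q) * suc (suc q) ≤ 2 * (suc q * suc q)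
  [2+q]²≤2*[1+q]² (suc (suc p)) (s≤s (s≤s z≤n)) = ≤-trans (m≤m+n _ (p * p + 4 * p + 2)) (≤-reflexive (expand p))
    where expand : ∀ p → (4 + p) * (4 + p) + (p * p + 4 * p + 2) ≡ 2 * ((3 + p) * (3 + p))
          expand = solve-∀

  private
    c*[1+Q]²≤2^Q : ∀ c → let Q = 3 * (9 * c + 1) in c * (suc Q * suc Q) ≤ 2 ^ Q
    c*[1+Q]²≤2^Q c = begin
      c * (suc Q * suc Q)             ≤⟨ *-monoʳ-≤ c (*-mono-≤ 1+Q≤3[1+t] 1+Q≤3[1+t]) ⟩
      c * (3 * suc t * (3 * suc t))   ≡⟨ regroup c (suc t) ⟩
      9 * c * (suc t * suc t)         ≤⟨ *-monoˡ-≤ (suc t * suc t) (≤-trans (n≤1+n (9 * c)) (≤-reflexive (+-comm 1 (9 * c)))) ⟩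
      t * (suc t * suc t)             ≤⟨ *-mono-≤ (<⇒≤ (n<2^n t)) (*-mono-≤ (n<2^n t) (n<2^n t)) ⟩
      2 ^ t * (2 ^ t * 2 ^ t)         ≡⟨ cong (λ e → 2 ^ t * (2 ^ t * 2 ^ e)) (+-identityʳ t) ⟨
      2 ^ t * (2 ^ t * 2 ^ (t + 0))   ≡⟨ cong (2 ^ t *_) (^-distribˡ-+-* 2 t (t + 0)) ⟨
      2 ^ t * 2 ^ (t + (t + 0))       ≡⟨ ^-distribˡ-+-* 2 t (t + (t + 0)) ⟨
      2 ^ Q                           ∎
      where
      open ≤-Reasoning
      t = 9 * c + 1
      Q = 3 * t
      1+Q≤3[1+t] : suc Q ≤ 3 * suc t
      1+Q≤3[1+t] = ≤-trans (n≤1+n (suc Q)) (≤-trans (n≤1+n (suc (suc Q))) (≤-reflexive (expand t)))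
        where expand : ∀ t → suc (suc (suc (3 * t))) ≡ 3 * suc t
              expand = solve-∀
      regroup : ∀ c u → c * (3 * u * (3 * u)) ≡ 9 * c * (u * u)
      regroup = solve-∀

  c*[1+q]²≤2^q-eventually : ∀ c → Σ ℕ λ Q → ∀ q → Q ≤ q → c * (suc q * suc q) ≤ 2 ^ q
  c*[1+q]²≤2^q-eventually c = Q , λ q Q≤q → subst bound (m+[n∸m]≡n Q≤q) (from-Q (q ∸ Q))
    where
    open ≤-Reasoning
    Q = 3 * (9 * c + 1)
    bound : ℕ → Set
    bound q = c * (suc q * suc q) ≤ 2 ^ q
    step : ∀ q → 2 ≤ q → bound q → bound (suc q)
    step q 2≤q ih = begin
      c * (suc (suc q) * suc (suc q)) ≤⟨ *-monoʳ-≤ c ([2+q]²≤2*[1+q]² q 2≤q) ⟩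
      c * (2 * (suc q * suc q))       ≡⟨ x∙yz≈y∙xz c 2 (suc q * suc q) ⟩
      2 * (c * (suc q * suc q))       ≤⟨ *-monoʳ-≤ 2 ih ⟩
      2 ^ suc q                       ∎
    from-Q : ∀ j → bound (Q + j)
    from-Q zero    = subst bound (sym (+-identityʳ Q)) (c*[1+Q]²≤2^Q c)
    from-Q (suc j) = subst bound (sym (+-suc Q j)) (step (Q + j) (≤-trans 2≤Q (m≤m+n Q j)) (from-Q j))
      where 2≤Q : 2 ≤ Q
            2≤Q = ≤-trans (s≤s (s≤s z≤n)) (*-monoʳ-≤ 3 (m≤n+m 1 (9 * c)))

  private
    L*[4M+4D[2+L]]≤2^L : ∀ M L q s → L ≡ s + q * 10 → s < 10 → (40 * M + 960) * (suc q * suc q) ≤ 2 ^ q →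
                         L * (4 * M + 4 * 2 ^ suc (9 * q + s) * (2 + L)) ≤ 2 ^ L
    L*[4M+4D[2+L]]≤2^L M L q s L≡ s<10 poly = begin
      L * (4 * M + 4 * (2 * E) * (2 + L))      ≡⟨ expand L M E ⟩
      L * (4 * M) + 8 * (L * (2 + L)) * E      ≤⟨ +-monoˡ-≤ (8 * (L * (2 + L)) * E) (m≤m*n (L * (4 * M)) E {{m^n≢0 2 (9 * q + s)}}) ⟩
      L * (4 * M) * E + 8 * (L * (2 + L)) * E  ≡⟨ *-distribʳ-+ E (L * (4 * M)) _ ⟨
      (L * (4 * M) + 8 * (L * (2 + L))) * E    ≤⟨ *-monoˡ-≤ E (≤-trans in-q poly) ⟩
      2 ^ q * E                                ≡⟨ ^-distribˡ-+-* 2 q (9 * q + s) ⟨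
      2 ^ (q + (9 * q + s))                    ≡⟨ cong (2 ^_) (trans (regroup q s) (sym L≡)) ⟩
      2 ^ L                                    ∎
      where
      open ≤-Reasoning
      E = 2 ^ (9 * q + s)
      u = suc q
      expand : ∀ L M E → L * (4 * M + 4 * (2 * E) * (2 + L)) ≡ L * (4 * M) + 8 * (L * (2 + L)) * E
      expand = solve-∀
      regroup : ∀ q s → q + (9 * q + s) ≡ s + q * 10
      regroup = solve-∀
      L≤10u : L ≤ 10 * u
      L≤10u = ≤-trans (≤-reflexive L≡) (≤-trans (+-monoˡ-≤ (q * 10) (<⇒≤ s<10)) (≤-reflexive (regroup′ q)))
        where regroup′ : ∀ q → 10 + q * 10 ≡ 10 * suc q
              regroup′ = solve-∀
      in-q : L * (4 * M) + 8 * (L * (2 + L)) ≤ (40 * M + 960) * (u * u)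
      in-q = begin
        L * (4 * M) + 8 * (L * (2 + L))
          ≤⟨ +-mono-≤ (*-monoˡ-≤ (4 * M) L≤10u) (*-monoʳ-≤ 8 (*-mono-≤ L≤10u (+-monoʳ-≤ 2 L≤10u))) ⟩
        10 * u * (4 * M) + 8 * (10 * u * (2 + 10 * u))
          ≤⟨ +-mono-≤ (m≤m*n (10 * u * (4 * M)) u) (*-monoʳ-≤ 8 (*-monoʳ-≤ (10 * u) (+-monoˡ-≤ (10 * u) (*-monoʳ-≤ 2 (s≤s (z≤n {q})))))) ⟩
        10 * u * (4 * M) * u + 8 * (10 * u * (2 * u + 10 * u))
          ≡⟨ collect M u ⟩
        (40 * M + 960) * (u * u) ∎
        where collect : ∀ M u → 10 * u * (4 * M) * u + 8 * (10 * u * (2 * u + 10 * u)) ≡ (40 * M + 960) * (u * u)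
              collect = solve-∀

  private
    Q≤q : ∀ Q L q s → 10 * Q + 10 ≤ suc L → L ≡ s + q * 10 → s < 10 → Q ≤ q
    Q≤q Q L q s 10Q+10≤1+L L≡ s<10 = *-cancelˡ-≤ 10 (+-cancelʳ-≤ 10 _ _ (begin
      10 * Q + 10        ≤⟨ 10Q+10≤1+L ⟩
      suc L              ≡⟨ cong suc L≡ ⟩
      suc s + q * 10     ≤⟨ +-monoˡ-≤ (q * 10) s<10 ⟩
      10 + q * 10        ≡⟨ +-comm 10 (q * 10) ⟩
      q * 10 + 10        ≡⟨ cong (_+ 10) (*-comm q 10) ⟩
      10 * q + 10        ∎))
      where open ≤-Reasoning

    n⁹≤[2^[1+9q+s]]¹⁰ : ∀ n L q s → n < 2 ^ suc L → L ≡ s + q * 10 → n ^ 9 ≤ (2 ^ suc (9 * q + s)) ^ 10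
    n⁹≤[2^[1+9q+s]]¹⁰ n L q s n<2^[1+L] L≡ = begin
      n ^ 9                        ≤⟨ ^-monoˡ-≤ 9 (<⇒≤ n<2^[1+L]) ⟩
      (2 ^ suc L) ^ 9              ≡⟨ ^-*-assoc 2 (suc L) 9 ⟩
      2 ^ (suc L * 9)              ≤⟨ ^-monoʳ-≤ 2 (≤-trans (m≤m+n (suc L * 9) (suc s)) (≤-reflexive exponents)) ⟩
      2 ^ (suc (9 * q + s) * 10)   ≡⟨ ^-*-assoc 2 (suc (9 * q + s)) 10 ⟨
      (2 ^ suc (9 * q + s)) ^ 10   ∎
      where
      open ≤-Reasoning
      exponents : suc L * 9 + suc s ≡ suc (9 * q + s) * 10
      exponents = trans (cong (λ l → suc l * 9 + suc s) L≡) (regroup s q)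
        where regroup : ∀ s q → suc (s + q * 10) * 9 + suc s ≡ suc (9 * q + s) * 10
              regroup = solve-∀

  -- With 2 ^ L ≤ n < 2 ^ (1 + L) and L = 10 q + s, the threshold D = 2 ^ (1 + 9 q + s) is about n ^ (9/10):
  -- large enough for n⁹ ≤ D¹⁰, small enough for L * (4 M + 4 D (2 + L)) ≤ 2 ^ L ≤ L * k.
  threshold-exists : ∀ M → Σ ℕ λ N → ∀ n k → N ≤ n → 2 ^ (4 * n) * 2 ^ k ≤ 2 * n ^ k →
    Σ ℕ λ D → (2 * M * 3 ^ n) * (2 * M * 3 ^ n) ≤ D ^ k
            × (2 * M * suc (2 * n) ^ (2 * D)) * (2 * M * suc (2 * n) ^ (2 * D)) ≤ 3 ^ k
  threshold-exists M with c*[1+q]²≤2^q-eventually (40 * M + 960)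
  ... | Q , poly≤exp = N , choose
    where
    N = 2 ^ (10 * Q + 10) + 2 ^ 9 * (2 * M) ^ 20
    choose : ∀ n k → N ≤ n → 2 ^ (4 * n) * 2 ^ k ≤ 2 * n ^ k →
      Σ ℕ λ D → (2 * M * 3 ^ n) * (2 * M * 3 ^ n) ≤ D ^ k
              × (2 * M * suc (2 * n) ^ (2 * D)) * (2 * M * suc (2 * n) ^ (2 * D)) ≤ 3 ^ k
    choose n k N≤n H with binary-magnitude n (≤-trans (m^n>0 2 (10 * Q + 10)) (≤-trans (m≤m+n _ _) N≤n))
    ... | L , lower , upper =
      D , large-threshold n k M D (≤-trans (m≤n+m _ (2 ^ (10 * Q + 10))) N≤n) (n⁹≤[2^[1+9q+s]]¹⁰ n L q s upper L≡) H
        , small-threshold n k M D L upper exponent≤k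
      where
      open ≤-Reasoning
      q = L / 10
      s = L % 10
      L≡ : L ≡ s + q * 10
      L≡ = m≡m%n+[m/n]*n L 10
      D = 2 ^ suc (9 * q + s)
      10Q+10≤1+L : 10 * Q + 10 ≤ suc L
      10Q+10≤1+L = ^-cancelʳ-≤ 2 (s≤s (s≤s z≤n)) (≤-trans (≤-trans (m≤m+n _ _) N≤n) (<⇒≤ upper))
      1≤L : 1 ≤ L
      1≤L = ≤-pred (≤-trans (s≤s (s≤s z≤n)) (≤-trans (m≤n+m 10 (10 * Q)) 10Q+10≤1+L))
      exponent≤k : 4 * M + 4 * D * (2 + L) ≤ k
      exponent≤k = *-cancelˡ-≤ L {{>-nonZero 1≤L}} (begin
        L * (4 * M + 4 * D * (2 + L))  ≤⟨ L*[4M+4D[2+L]]≤2^L M L q s L≡ (m%n<n L 10)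
                                            (poly≤exp q (Q≤q Q L q s 10Q+10≤1+L L≡ (m%n<n L 10))) ⟩
        2 ^ L                          ≤⟨ lower ⟩
        n                              ≤⟨ n≤L*k n k L (≤-trans (m^n>0 2 L) lower) upper H ⟩
        L * k                          ∎)

  toℚᵘ-/ : ∀ a b .{{_ : NonZero b}} → toℚᵘ ((ℤ.+ a) ℚ./ b) ℚᵘ.≃ mkℚᵘ (ℤ.+ a) (pred b)
  toℚᵘ-/ a (suc b) = ℚ.toℚᵘ-fromℚᵘ (mkℚᵘ (ℤ.+ a) b)

  mkℚᵘ-≤⇒ : ∀ {a b c d} → mkℚᵘ (ℤ.+ a) b ℚᵘ.≤ mkℚᵘ (ℤ.+ c) d → a * suc d ≤ c * suc b
  mkℚᵘ-≤⇒ {a} {b} {c} {d} (*≤* le) = ℤ.drop‿+≤+ (subst₂ ℤ._≤_ (sym (ℤ.pos-* a (suc d))) (sym (ℤ.pos-* c (suc b))) le)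

  ⇒mkℚᵘ-≤ : ∀ {a b c d} → a * suc d ≤ c * suc b → mkℚᵘ (ℤ.+ a) b ℚᵘ.≤ mkℚᵘ (ℤ.+ c) d
  ⇒mkℚᵘ-≤ {a} {b} {c} {d} le = *≤* (subst₂ ℤ._≤_ (ℤ.pos-* a (suc d)) (ℤ.pos-* c (suc b)) (ℤ.+≤+ le))

  /≤/⇒*≤* : ∀ a b c d .{{_ : NonZero b}} .{{_ : NonZero d}} → (ℤ.+ a) ℚ./ b ℚ.≤ (ℤ.+ c) ℚ./ d → a * d ≤ c * b
  /≤/⇒*≤* a b@(suc _) c d@(suc _) le =
    mkℚᵘ-≤⇒ (ℚᵘ.≤-respʳ-≃ (toℚᵘ-/ c d) (ℚᵘ.≤-respˡ-≃ (toℚᵘ-/ a b) (ℚ.toℚᵘ-mono-≤ le)))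

  /1*/≡*/ : ∀ a b c .{{_ : NonZero c}} → ((ℤ.+ a) ℚ./ 1) ℚ.* ((ℤ.+ b) ℚ./ c) ≡ (ℤ.+ (a * b)) ℚ./ c
  /1*/≡*/ a b c@(suc c-1) = ℚ.toℚᵘ-injective (ℚᵘ.≃-trans (ℚ.toℚᵘ-homo-* ((ℤ.+ a) ℚ./ 1) ((ℤ.+ b) ℚ./ c))
    (ℚᵘ.≃-trans (ℚᵘ.*-cong (toℚᵘ-/ a 1) (toℚᵘ-/ b c))
    (ℚᵘ.≃-trans (*≡* (cong₂ ℤ._*_ (sym (ℤ.pos-* a b)) (cong (λ m → ℤ.+ suc m) (sym (+-identityʳ c-1)))))
    (ℚᵘ.≃-sym (toℚᵘ-/ (a * b) c)))))

  -- ε ≥ 1/(q + 1), and the hypothesis says G/Ω ≥ 1 − 1/(q + 1).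
  1-ε≤G/Ω : ∀ p q .(c : Coprime (suc p) (suc q)) G Ω .{{_ : NonZero Ω}} →
            Ω * suc q ≤ G * suc q + Ω → 1ℚ ℚ.- mkℚ +[1+ p ] q c ℚ.≤ (ℤ.+ G) ℚ./ Ω
  1-ε≤G/Ω p q c G Ω@(suc Ω-1) Ω*d≤G*d+Ω =
    ℚ.≤-trans (ℚ.+-monoˡ-≤ (ℚ.- ε) 1≤G/Ω+ε) (ℚ.≤-reflexive G/Ω+ε-ε≡G/Ω)
    where
    ε = mkℚ +[1+ p ] q c
    G/Ω+ε-ε≡G/Ω : (ℤ.+ G) ℚ./ Ω ℚ.+ ε ℚ.- ε ≡ (ℤ.+ G) ℚ./ Ω
    G/Ω+ε-ε≡G/Ω = trans (ℚ.+-assoc ((ℤ.+ G) ℚ./ Ω) ε (ℚ.- ε))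
                        (trans (cong ((ℤ.+ G) ℚ./ Ω ℚ.+_) (ℚ.+-inverseʳ ε)) (ℚ.+-identityʳ _))
    sum≃ : toℚᵘ ((ℤ.+ G) ℚ./ Ω ℚ.+ ε) ℚᵘ.≃ mkℚᵘ (ℤ.+ (G * suc q + suc p * Ω)) (q + Ω-1 * suc q)
    sum≃ = ℚᵘ.≃-trans (ℚ.toℚᵘ-homo-+ ((ℤ.+ G) ℚ./ Ω) ε) (ℚᵘ.≃-trans (ℚᵘ.+-cong (toℚᵘ-/ G Ω) ℚᵘ.≃-refl)
             (*≡* (cong (ℤ._* (ℤ.+ suc (q + Ω-1 * suc q)))
                        (trans (cong₂ ℤ._+_ (sym (ℤ.pos-* G (suc q))) (sym (ℤ.pos-* (suc p) Ω))) (sym (ℤ.pos-+ (G * suc q) (suc p * Ω)))))))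
    1≤G/Ω+ε : 1ℚ ℚ.≤ (ℤ.+ G) ℚ./ Ω ℚ.+ ε
    1≤G/Ω+ε = ℚ.toℚᵘ-cancel-≤ (ℚᵘ.≤-respʳ-≃ (ℚᵘ.≃-sym sum≃) (⇒mkℚᵘ-≤ (begin
      1 * suc (q + Ω-1 * suc q)     ≡⟨ denominator Ω-1 q ⟩
      Ω * suc q                     ≤⟨ Ω*d≤G*d+Ω ⟩
      G * suc q + Ω                 ≤⟨ +-monoʳ-≤ (G * suc q) (m≤m+n Ω (p * Ω)) ⟩
      G * suc q + suc p * Ω         ≡⟨ *-identityʳ _ ⟨
      (G * suc q + suc p * Ω) * 1   ∎)))
      where
      open ≤-Reasoning
      denominator : ∀ Ω-1 q → 1 * suc (q + Ω-1 * suc q) ≡ suc Ω-1 * suc q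
      denominator = solve-∀

  -- The hypothesis on k

  expPartial-nonNeg : ∀ t m → 0ℚ ℚ.≤ expPartial t m
  expPartial-nonNeg t zero    = ℚ.≤-refl
  expPartial-nonNeg t (suc m) = ℚ.+-mono-≤ (expPartial-nonNeg t m)
    (ℚ.nonNegative⁻¹ _ {{ℚ.normalize-nonNeg (t ^ m) (m !) {{m !≢0}}}})

  t^t/t!≤expPartial : ∀ t → ℚ._/_ (ℤ.+ (t ^ t)) (t !) {{t !≢0}} ℚ.≤ expPartial t (suc t)
  t^t/t!≤expPartial t = ℚ.≤-trans (ℚ.≤-reflexive (sym (ℚ.+-identityˡ _))) (ℚ.+-monoˡ-≤ _ (expPartial-nonNeg t t))

  bernoulli : ∀ x j → x ^ j * (x + j) ≤ x * (x + 1) ^ j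
  bernoulli x zero    = ≤-reflexive (base x)
    where base : ∀ x → 1 * (x + 0) ≡ x * 1
          base = solve-∀
  bernoulli x (suc j) = begin
    x * x ^ j * (x + suc j)                ≤⟨ m≤m+n _ (x ^ j * j) ⟩
    x * x ^ j * (x + suc j) + x ^ j * j    ≡⟨ regroup x j (x ^ j) ⟩
    x ^ j * (x + j) * (x + 1)              ≤⟨ *-monoˡ-≤ (x + 1) (bernoulli x j) ⟩
    x * (x + 1) ^ j * (x + 1)              ≡⟨ regroup′ x ((x + 1) ^ j) ⟩
    x * ((x + 1) * (x + 1) ^ j)            ∎
    where
    open ≤-Reasoning
    regroup : ∀ x j y → x * y * (x + suc j) + y * j ≡ y * (x + j) * (x + 1)
    regroup = solve-∀
    regroup′ : ∀ x y → x * y * (x + 1) ≡ x * ((x + 1) * y)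
    regroup′ = solve-∀

  2^j*j!≤2*j^j : ∀ j → 2 ^ j * j ! ≤ 2 * j ^ j
  2^j*j!≤2*j^j zero          = s≤s z≤n
  2^j*j!≤2*j^j (suc zero)    = ≤-refl
  2^j*j!≤2*j^j (suc j@(suc _)) = begin
    2 * 2 ^ j * (suc j * j !)      ≡⟨ regroup (2 ^ j) (j !) (suc j) ⟩
    2 * suc j * (2 ^ j * j !)      ≤⟨ *-monoʳ-≤ (2 * suc j) (2^j*j!≤2*j^j j) ⟩
    2 * suc j * (2 * j ^ j)        ≤⟨ *-monoʳ-≤ (2 * suc j) 2*j^j≤[1+j]^j ⟩
    2 * suc j * suc j ^ j          ≡⟨ *-assoc 2 (suc j) (suc j ^ j) ⟩
    2 * suc j ^ suc j              ∎
    where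
    open ≤-Reasoning
    regroup : ∀ a b c → 2 * a * (c * b) ≡ 2 * c * (a * b)
    regroup = solve-∀
    2*j^j≤[1+j]^j : 2 * j ^ j ≤ suc j ^ j
    2*j^j≤[1+j]^j = *-cancelˡ-≤ j (begin
      j * (2 * j ^ j)    ≡⟨ regroup′ j (j ^ j) ⟩
      j ^ j * (j + j)    ≤⟨ bernoulli j j ⟩
      j * (j + 1) ^ j    ≡⟨ cong (λ x → j * x ^ j) (+-comm j 1) ⟩
      j * suc j ^ j      ∎)
      where regroup′ : ∀ j y → j * (2 * y) ≡ y * (j + j)
            regroup′ = solve-∀

  -- Only the term i = 2n of the exponential series is used.
  KBound⇒4^n*[2n]^[2n]*2^k≤n^k*[2n]! : ∀ n k → KBound n k → 4 ^ n * (2 * n) ^ (2 * n) * 2 ^ k ≤ n ^ k * (2 * n) !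
  KBound⇒4^n*[2n]^[2n]*2^k≤n^k*[2n]! n k bound = /≤/⇒*≤* (4 ^ n * t ^ t) (t !) (n ^ k) (2 ^ k) (begin
    (ℤ.+ (4 ^ n * t ^ t)) ℚ./ t !                    ≡⟨ /1*/≡*/ (4 ^ n) (t ^ t) (t !) ⟨
    ((ℤ.+ (4 ^ n)) ℚ./ 1) ℚ.* ((ℤ.+ (t ^ t)) ℚ./ t !)  ≤⟨ ℚ.*-monoˡ-≤-nonNeg ((ℤ.+ (4 ^ n)) ℚ./ 1) {{ℚ.normalize-nonNeg (4 ^ n) 1}}
                                                                        (t^t/t!≤expPartial t) ⟩
    ((ℤ.+ (4 ^ n)) ℚ./ 1) ℚ.* expPartial t (suc t)   ≤⟨ bound (suc t) ⟩
    (ℤ.+ (n ^ k)) ℚ./ 2 ^ k                          ∎)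
    where
    open ℚ.≤-Reasoning
    t = 2 * n
    instance
      t!≢0 : NonZero (t !)
      t!≢0 = t !≢0
      2^k≢0 : NonZero (2 ^ k)
      2^k≢0 = m^n≢0 2 k

  KBound⇒2^[4n]*2^k≤2*n^k : ∀ n k → KBound n k → 2 ^ (4 * n) * 2 ^ k ≤ 2 * n ^ k
  KBound⇒2^[4n]*2^k≤2*n^k n k bound = *-cancelʳ-≤ _ _ (t ^ t) {{n^n≢0 t}} (begin
    2 ^ (4 * n) * 2 ^ k * t ^ t        ≡⟨ cong (λ x → x * 2 ^ k * t ^ t) 2^[4n]≡4^n*2^t ⟩
    4 ^ n * 2 ^ t * 2 ^ k * t ^ t      ≡⟨ regroup (4 ^ n) (2 ^ t) (2 ^ k) (t ^ t) ⟩
    4 ^ n * t ^ t * 2 ^ k * 2 ^ t      ≤⟨ *-monoˡ-≤ (2 ^ t) (KBound⇒4^n*[2n]^[2n]*2^k≤n^k*[2n]! n k bound) ⟩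
    n ^ k * t ! * 2 ^ t                ≡⟨ regroup′ (n ^ k) (t !) (2 ^ t) ⟩
    n ^ k * (2 ^ t * t !)              ≤⟨ *-monoʳ-≤ (n ^ k) (2^j*j!≤2*j^j t) ⟩
    n ^ k * (2 * t ^ t)                ≡⟨ regroup″ (n ^ k) (t ^ t) ⟩
    2 * n ^ k * t ^ t                  ∎)
    where
    open ≤-Reasoning
    t = 2 * n
    2^[4n]≡4^n*2^t : 2 ^ (4 * n) ≡ 4 ^ n * 2 ^ t
    2^[4n]≡4^n*2^t = trans (cong (2 ^_) (split n)) (trans (^-distribˡ-+-* 2 (2 * n) t) (cong (_* 2 ^ t) (sym (^-*-assoc 2 2 n))))
      where split : ∀ n → 4 * n ≡ 2 * n + 2 * n
            split = solve-∀
    regroup : ∀ a b c d → a * b * c * d ≡ a * d * c * b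
    regroup = solve-∀
    regroup′ : ∀ a b c → a * b * c ≡ a * (c * b)
    regroup′ = solve-∀
    regroup″ : ∀ a b → a * (2 * b) ≡ 2 * a * b
    regroup″ = solve-∀

  resolving-bound : ∀ {m} k (x : Fin (suc m)) M D → 1 ≤ m →
    (2 * M * 3 ^ suc m) * (2 * M * 3 ^ suc m) ≤ D ^ k →
    (2 * M * suc (2 * suc m) ^ (2 * D)) * (2 * M * suc (2 * suc m) ^ (2 * D)) ≤ 3 ^ k →
    2 ^ (suc m * k) * M ≤ #resolving k x * M + 2 ^ (suc m * k)
  resolving-bound {m} k x M D 1≤m K₁²≤Dᵏ K₂²≤3ᵏ = begin
    Ω * M            ≤⟨ *-monoˡ-≤ M (#resolving+#undetected≥2^[nk] k x 1≤m) ⟩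
    (G + Σw) * M     ≡⟨ *-distribʳ-+ M G Σw ⟩
    G * M + Σw * M   ≤⟨ +-monoʳ-≤ (G * M) (≤-trans (≤-reflexive (*-comm Σw M))
                                                  (undetected-sum-bound (suc m) k M D K₁²≤Dᵏ K₂²≤3ᵏ)) ⟩
    G * M + Ω        ∎
    where
    open ≤-Reasoning
    Ω = 2 ^ (suc m * k)
    G = #resolving k x
    Σw = sum (map (undetectedWeight k) (allDiffs (suc m)))

  -- N is huge in unary: it is taken apart with projections rather than with, which would normalise it.
  few-unresolved : ∀ M → Σ ℕ λ N → ∀ m k (x : Fin (suc m)) → N ≤ m → KBound (suc m) k →
                   2 ^ (suc m * k) * M ≤ #resolving k x * M + 2 ^ (suc m * k)
  few-unresolved M = suc N , λ m k x N<m bound →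
    let D , K₁²≤Dᵏ , K₂²≤3ᵏ = choose (suc m) k (≤-trans (<⇒≤ N<m) (n≤1+n m)) (KBound⇒2^[4n]*2^k≤2*n^k (suc m) k bound)
    in  resolving-bound k x M D (≤-trans (s≤s z≤n) N<m) K₁²≤Dᵏ K₂²≤3ᵏ
    where
    N = proj₁ (threshold-exists M)
    choose = proj₂ (threshold-exists M)

open import Data.Nat using (ℕ; suc; _≤_)
open import Data.Fin using (Fin)
open import Data.Rational using (ℚ; 0ℚ; 1ℚ; _<_; _-_) renaming (_≤_ to _≤ℚ_)
open import Data.Product using (Σ)

open import Data.Integer using (+0; +[1+_]; -[1+_]; +<+)
open import Data.Nat using (_+_; _*_; _^_; s≤s)
open import Data.Nat.Properties using (≤-trans; m≤m+n; m≤n+m; m^n≢0)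
open import Data.Product using (_,_; proj₁; proj₂)
open import Data.Rational using (mkℚ; *<*)

theorem1 : (k : ℕ → ℕ) → (x : (m : ℕ) → Fin (suc m)) →
           ((m : ℕ) → 3 ≤ suc m → KBound (suc m) (k m)) →
           (ε : ℚ) → 0ℚ < ε →
           Σ ℕ (λ N → (m : ℕ) → N ≤ m →
             1ℚ - ε ≤ℚ probResolves (suc m) (k m) (x m))
theorem1 k x hyp (mkℚ +0       _ _) (*<* (+<+ ()))
theorem1 k x hyp (mkℚ -[1+ _ ] _ _) (*<* ())
theorem1 k x hyp (mkℚ +[1+ p ] q c) _ = N + 2 , λ m N+2≤m →
  1-ε≤G/Ω p q c (#resolving (k m) (x m)) (2 ^ (suc m * k m)) {{m^n≢0 2 (suc m * k m)}}
    (bound m (k m) (x m) (≤-trans (m≤m+n N 2) N+2≤m) (hyp m (s≤s (≤-trans (m≤n+m 2 N) N+2≤m))))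
  where
  N = proj₁ (few-unresolved (suc q))
  bound = proj₂ (few-unresolved (suc q))
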